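{- Let $t\ge0$, $m\ge0$ and $0\le r<q^m$ be integers. Then for all $x\in\mathbf F_q[[T]]$, $$\Delta_{r,m}(x)^{q^t}=\sum_{n\ge0}C^{(t)}_{r,n}\mathcal D_n(x),$$ where, writing $n=lq^m+s$ with $0\le s<q^m$ and $l\ge0$, $C^{(t)}_{r,n}=(-1)^{n-r}\binom{s}{r}T^{s-r}(T^{q^m}-T^{q^t})^l$ (interpreted as $0$ when $s<r$).
   Context: $q$ is a power of a prime. For integers $m\ge0$ and $0\le r<q^m$, the Cartier operator $\Delta_{r,m}$ on $\mathbf F_q[[T]]$ is $\Delta_{r,m}(\sum_{n\ge0}x_nT^n)=\sum_{n\ge0}x_{nq^m+r}T^n$. The Hasse derivatives are $\mathcal D_n(\sum_{i\ge0}x_iT^i)=\sum_{i\ge n}\binom{i}{n}x_iT^{i-n}$. -}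

module Defs where

open import Level using (Level; _⊔_)
open import Algebra.Bundles using (CommutativeRing)
open import Data.Nat as ℕ using (ℕ; zero; suc; _∸_; _^_; _<ᵇ_; _≥_)
open import Data.Nat.DivMod using (_/_; _%_)
open import Data.Nat.Combinatorics using (_C_)
open import Data.Nat.Primality using (Prime)
open import Data.Fin using (Fin)
open import Data.Bool using (if_then_else_)
open import Data.Product using (Σ; ∃; _×_; _,_)
open import Relation.Binary.PropositionalEquality using (_≡_)
open import Relation.Nullary using (¬_)

-- Decomposition n = l * Q + s with 0 ≤ s < Q (for Q ≥ 1); returns (l , s).
-- (The case Q = 0 never occurs below since Q = q ^ m with q ≥ 2.)
split : ℕ → ℕ → ℕ × ℕ
split zero    n = 0 , n
split (suc Q) n = n / suc Q , n % suc Q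

module _ {c ℓ : Level} (R : CommutativeRing c ℓ) where
  open CommutativeRing R

  record IsFiniteField (q : ℕ) : Set (c ⊔ ℓ) where
    field
      p        : ℕ
      k        : ℕ
      p-prime  : Prime p
      k≥1      : k ≥ 1
      q≡p^k    : q ≡ p ^ k
      1≉0      : ¬ (1# ≈ 0#)
      inverse  : ∀ x → ¬ (x ≈ 0#) → ∃ λ y → x * y ≈ 1#
      enum     : Fin q → Carrier
      enum-inj : ∀ i j → enum i ≈ enum j → i ≡ j
      enum-surj : ∀ x → ∃ λ i → enum i ≈ x

  PS : Set c
  PS = ℕ → Carrier

  _≈ₚ_ : PS → PS → Set ℓ
  f ≈ₚ g = ∀ n → f n ≈ g n

  ι : ℕ → Carrier
  ι zero    = 0#
  ι (suc n) = 1# + ι n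

  sgn : ℕ → Carrier
  sgn zero    = 1#
  sgn (suc n) = - sgn n

  sumR : ℕ → (ℕ → Carrier) → Carrier
  sumR zero    f = 0#
  sumR (suc n) f = sumR n f + f n

  zeroₚ : PS
  zeroₚ _ = 0#

  oneₚ : PS
  oneₚ zero    = 1#
  oneₚ (suc _) = 0#

  Tpow : ℕ → PS
  Tpow j n = if (n ℕ.≡ᵇ j) then 1# else 0#

  _+ₚ_ : PS → PS → PS
  (f +ₚ g) n = f n + g n

  _-ₚ_ : PS → PS → PS
  (f -ₚ g) n = f n - g n

  scaleₚ : Carrier → PS → PS
  scaleₚ a f n = a * f n

  _*ₚ_ : PS → PS → PS
  (f *ₚ g) n = sumR (suc n) (λ i → f i * g (n ∸ i))

  _^ₚ_ : PS → ℕ → PS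
  f ^ₚ zero  = oneₚ
  f ^ₚ suc e = f *ₚ (f ^ₚ e)

  sumₚ : ℕ → (ℕ → PS) → PS
  sumₚ N F i = sumR N (λ n → F n i)

  Δ : (q r m : ℕ) → PS → PS
  Δ q r m x n = x (n ℕ.* q ^ m ℕ.+ r)

  D : ℕ → PS → PS
  D n x i = ι ((i ℕ.+ n) C n) * x (i ℕ.+ n)

  Coef : (q t r m n : ℕ) → PS
  Coef q t r m n with split (q ^ m) n
  ... | l , s = if s <ᵇ r then zeroₚ
                else scaleₚ (sgn (n ∸ r) * ι (s C r))
                       (Tpow (s ∸ r) *ₚ ((Tpow (q ^ m) -ₚ Tpow (q ^ t)) ^ₚ l))

  -- The series Σ_{n ≥ 0} F n converges (T-adically, i.e. coefficientwise
  -- stabilisation of the partial sums) to y.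
  ConvergesTo : (ℕ → PS) → PS → Set ℓ
  ConvergesTo F y = ∀ i → ∃ λ N → ∀ N′ → N′ ≥ N → sumₚ N′ F i ≈ y i

-- Write Q = q^m, P = q^t and C_n = C^{(t)}_{r,n}, and compare the two sides coefficientwise.
-- Since R has characteristic p and a^q = a on R, the Frobenius endomorphism gives
-- Δ(x)^P = Σ_a x_{aQ+r} T^{aP}.  On the other side, D_n(x) = Σ_k x_k C(k,n) T^{k-n}, so
-- Σ_n C_n D_n(x) = Σ_k x_k K_k with K_k = Σ_{n≤k} C_n C(k,n) T^{k-n}.  Lucas' congruence
-- C(k+Q,n) ≡ C(k,n) + C(k,n-Q) (mod p) and C_{n+Q} = -(T^Q - T^P) C_n give K_{k+Q} = T^P K_k,
-- while for b < Q binomial inversion Σ_n (-1)^{n-r} C(n,r) C(b,n) = δ_{br} gives K_b = δ_{br}.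
-- Hence K_{aQ+b} = δ_{br} T^{aP}.  Finally C_n is divisible by T^{i+1} once n ≥ (i+1)Q,
-- so the i-th coefficient of the partial sums is constant from then on.
module Submission where

open import Level using (Level)
open import Algebra.Bundles using (CommutativeRing)
open import Data.Nat as ℕ using (ℕ; zero; suc; _∸_; _≤_; _<_; z≤n; s≤s; NonZero)
import Data.Nat.Properties as ℕₚ
open import Data.Sum using (inj₁; inj₂)
open import Data.Empty using (⊥-elim)
open import Data.Bool using (true; false; if_then_else_; T)
open import Data.Product using (_,_)
open import Relation.Nullary using (¬_; yes; no)
open import Relation.Binary.PropositionalEquality as ≡ using (_≡_; _≢_)
open import Data.Nat.Primality using (Prime; prime⇒nonZero)
open import Defs

<ᵇ-true : ∀ {m n} → m < n → (m ℕ.<ᵇ n) ≡ true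
<ᵇ-true {m} {n} m<n with m ℕ.<ᵇ n | ℕₚ.<⇒<ᵇ m<n
... | true | _ = ≡.refl

<ᵇ-false : ∀ {m n} → ¬ m < n → (m ℕ.<ᵇ n) ≡ false
<ᵇ-false {m} {n} m≮n with m ℕ.<ᵇ n in eq
... | true  = ⊥-elim (m≮n (ℕₚ.<ᵇ⇒< m n (≡.subst T (≡.sym eq) _)))
... | false = ≡.refl

split-*+ : ∀ Q l s → s < Q → split Q (l ℕ.* Q ℕ.+ s) ≡ (l , s)
split-*+ (suc Q) l s s<Q = ≡.cong₂ _,_ quotient remainder
  where
    open import Data.Nat.DivMod using (_/_; _%_; m≡m%n+[m/n]*n; [m+kn]%n≡m%n; m<n⇒m%n≡m)
    n : ℕ
    n = l ℕ.* suc Q ℕ.+ s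
    remainder : n % suc Q ≡ s
    remainder = ≡.trans (≡.cong (_% suc Q) (ℕₚ.+-comm (l ℕ.* suc Q) s))
                        (≡.trans ([m+kn]%n≡m%n s l (suc Q)) (m<n⇒m%n≡m s<Q))
    quotient : n / suc Q ≡ l
    quotient = ℕₚ.*-cancelʳ-≡ _ _ (suc Q) (ℕₚ.+-cancelˡ-≡ s _ _ (≡.sym (begin
      s ℕ.+ l ℕ.* suc Q               ≡⟨ ℕₚ.+-comm s (l ℕ.* suc Q) ⟩
      n                               ≡⟨ m≡m%n+[m/n]*n n (suc Q) ⟩
      n % suc Q ℕ.+ n / suc Q ℕ.* suc Q ≡⟨ ≡.cong (ℕ._+ n / suc Q ℕ.* suc Q) remainder ⟩
      s ℕ.+ n / suc Q ℕ.* suc Q       ∎)))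
      where open ≡.≡-Reasoning

module Sums {c ℓ : Level} (S : CommutativeRing c ℓ) where
  open CommutativeRing S hiding (zero)
  open import Relation.Binary.Reasoning.Setoid setoid
  open import Algebra.Properties.CommutativeSemigroup +-commutativeSemigroup using () renaming (interchange to +-interchange)

  Σ : ℕ → (ℕ → Carrier) → Carrier
  Σ = sumR S

  Σ-cong : ∀ n {f g} → (∀ i → i < n → f i ≈ g i) → Σ n f ≈ Σ n g
  Σ-cong zero    f≈g = refl
  Σ-cong (suc n) f≈g = +-cong (Σ-cong n (λ i i<n → f≈g i (ℕₚ.m<n⇒m<1+n i<n))) (f≈g n ℕₚ.≤-refl)

  Σ-cong′ : ∀ n {f g} → (∀ i → f i ≈ g i) → Σ n f ≈ Σ n g
  Σ-cong′ n f≈g = Σ-cong n (λ i _ → f≈g i)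

  Σ-distrib-+ : ∀ n f g → Σ n (λ i → f i + g i) ≈ Σ n f + Σ n g
  Σ-distrib-+ zero    f g = sym (+-identityˡ 0#)
  Σ-distrib-+ (suc n) f g = trans (+-congʳ (Σ-distrib-+ n f g)) (+-interchange _ _ _ _)

  *-distribˡ-Σ : ∀ n a f → a * Σ n f ≈ Σ n (λ i → a * f i)
  *-distribˡ-Σ zero    a f = zeroʳ a
  *-distribˡ-Σ (suc n) a f = trans (distribˡ a _ _) (+-congʳ (*-distribˡ-Σ n a f))

  *-distribʳ-Σ : ∀ n a f → Σ n f * a ≈ Σ n (λ i → f i * a)
  *-distribʳ-Σ n a f = trans (*-comm _ a) (trans (*-distribˡ-Σ n a f) (Σ-cong′ n (λ i → *-comm a (f i))))

  Σ-zero : ∀ n {f} → (∀ i → i < n → f i ≈ 0#) → Σ n f ≈ 0#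
  Σ-zero n {f} f≈0 = trans (Σ-cong n f≈0) (Σ0 n)
    where
      Σ0 : ∀ n → Σ n (λ _ → 0#) ≈ 0#
      Σ0 zero    = refl
      Σ0 (suc n) = trans (+-identityʳ _) (Σ0 n)

  Σ-suc : ∀ n f → Σ (suc n) f ≈ f 0 + Σ n (λ i → f (suc i))
  Σ-suc zero    f = trans (+-identityˡ _) (sym (+-identityʳ _))
  Σ-suc (suc n) f = trans (+-congʳ (Σ-suc n f)) (+-assoc _ _ _)

  Σ-+ : ∀ m n f → Σ (m ℕ.+ n) f ≈ Σ m f + Σ n (λ i → f (m ℕ.+ i))
  Σ-+ m zero    f = ≡.subst (λ k → Σ k f ≈ Σ m f + 0#) (≡.sym (ℕₚ.+-identityʳ m)) (sym (+-identityʳ _))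
  Σ-+ m (suc n) f = begin
    Σ (m ℕ.+ suc n) f                                ≡⟨ ≡.cong (λ k → Σ k f) (ℕₚ.+-suc m n) ⟩
    Σ (m ℕ.+ n) f + f (m ℕ.+ n)                      ≈⟨ +-congʳ (Σ-+ m n f) ⟩
    (Σ m f + Σ n (λ i → f (m ℕ.+ i))) + f (m ℕ.+ n)  ≈⟨ +-assoc _ _ _ ⟩
    Σ m f + Σ (suc n) (λ i → f (m ℕ.+ i))            ∎

  Σ-extend : ∀ m k f → (∀ i → m ≤ i → f i ≈ 0#) → Σ (m ℕ.+ k) f ≈ Σ m f
  Σ-extend m k f tail≈0 = trans (Σ-+ m k f)
    (trans (+-congˡ (Σ-zero k (λ i _ → tail≈0 (m ℕ.+ i) (ℕₚ.m≤m+n m i)))) (+-identityʳ _))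

  Σ-extend-≤ : ∀ m n f → m ≤ n → (∀ i → m ≤ i → f i ≈ 0#) → Σ n f ≈ Σ m f
  Σ-extend-≤ m n f m≤n tail≈0 =
    ≡.subst (λ k → Σ k f ≈ Σ m f) (ℕₚ.m+[n∸m]≡n m≤n) (Σ-extend m (n ∸ m) f tail≈0)

  Σ-single : ∀ n j f → j < n → (∀ i → i < n → i ≢ j → f i ≈ 0#) → Σ n f ≈ f j
  Σ-single (suc n) j f j<1+n others≈0 with ℕₚ.m≤n⇒m<n∨m≡n (ℕₚ.≤-pred j<1+n)
  ... | inj₁ j<n = trans (+-congˡ (others≈0 n ℕₚ.≤-refl (λ n≡j → ℕₚ.<-irrefl (≡.sym n≡j) j<n)))
                     (trans (+-identityʳ _) (Σ-single n j f j<n (λ i i<n → others≈0 i (ℕₚ.m<n⇒m<1+n i<n))))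
  ... | inj₂ ≡.refl = trans (+-congʳ (Σ-zero n (λ i i<n → others≈0 i (ℕₚ.m<n⇒m<1+n i<n) (λ i≡n → ℕₚ.<-irrefl i≡n i<n))))
                        (+-identityˡ _)

  Σ-comm : ∀ m n (F : ℕ → ℕ → Carrier) → Σ m (λ i → Σ n (F i)) ≈ Σ n (λ j → Σ m (λ i → F i j))
  Σ-comm zero    n F = sym (Σ-zero n (λ _ _ → refl))
  Σ-comm (suc m) n F = trans (+-congʳ (Σ-comm m n F)) (sym (Σ-distrib-+ n _ _))

  Σ-reverse : ∀ n f → Σ n f ≈ Σ n (λ i → f (n ∸ suc i))
  Σ-reverse zero    f = refl
  Σ-reverse (suc n) f = begin
    Σ n f + f n                         ≈⟨ +-comm _ _ ⟩
    f n + Σ n f                         ≈⟨ +-congˡ (Σ-reverse n f) ⟩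
    f n + Σ n (λ i → f (n ∸ suc i))     ≈⟨ sym (Σ-suc n (λ i → f (n ∸ i))) ⟩
    Σ (suc n) (λ i → f (n ∸ i))         ∎

  Σ-* : ∀ a b f → Σ (a ℕ.* b) f ≈ Σ a (λ i → Σ b (λ j → f (i ℕ.* b ℕ.+ j)))
  Σ-* zero    b f = refl
  Σ-* (suc a) b f = begin
    Σ (b ℕ.+ a ℕ.* b) f                                  ≡⟨ ≡.cong (λ k → Σ k f) (ℕₚ.+-comm b (a ℕ.* b)) ⟩
    Σ (a ℕ.* b ℕ.+ b) f                                  ≈⟨ Σ-+ (a ℕ.* b) b f ⟩
    Σ (a ℕ.* b) f + Σ b (λ j → f (a ℕ.* b ℕ.+ j))        ≈⟨ +-congʳ (Σ-* a b f) ⟩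
    Σ (suc a) (λ i → Σ b (λ j → f (i ℕ.* b ℕ.+ j)))      ∎

  Σ-telescope : ∀ n (f : ℕ → Carrier) → Σ n (λ j → - f j + f (suc j)) ≈ - f 0 + f n
  Σ-telescope zero    f = sym (-‿inverseˡ _)
  Σ-telescope (suc n) f = begin
    Σ n (λ j → - f j + f (suc j)) + (- f n + f (suc n)) ≈⟨ +-congʳ (Σ-telescope n f) ⟩
    (- f 0 + f n) + (- f n + f (suc n))                 ≈⟨ +-assoc _ _ _ ⟩
    - f 0 + (f n + (- f n + f (suc n)))                 ≈⟨ +-congˡ (sym (+-assoc _ _ _)) ⟩
    - f 0 + ((f n + - f n) + f (suc n))                 ≈⟨ +-congˡ (+-congʳ (-‿inverseʳ _)) ⟩
    - f 0 + (0# + f (suc n))                            ≈⟨ +-congˡ (+-identityˡ _) ⟩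
    - f 0 + f (suc n)                                   ∎

  Σ-triangle : ∀ n (F : ℕ → ℕ → Carrier) →
    Σ (suc n) (λ i → Σ (suc i) (F i)) ≈ Σ (suc n) (λ a → Σ (suc (n ∸ a)) (λ b → F (a ℕ.+ b) a))
  Σ-triangle zero    F = refl
  Σ-triangle (suc n) F = begin
    Σ (suc n) (λ i → Σ (suc i) (F i)) + (Σ (suc n) (F (suc n)) + F (suc n) (suc n))
      ≈⟨ +-congʳ (Σ-triangle n F) ⟩
    Σ (suc n) row + (Σ (suc n) (F (suc n)) + F (suc n) (suc n))
      ≈⟨ sym (+-assoc _ _ _) ⟩
    (Σ (suc n) row + Σ (suc n) (F (suc n))) + F (suc n) (suc n)
      ≈⟨ +-cong (sym (Σ-distrib-+ (suc n) row (F (suc n)))) (sym lastRow) ⟩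
    Σ (suc n) (λ a → row a + F (suc n) a) + row′ (suc n)
      ≈⟨ +-congʳ (Σ-cong (suc n) (λ a a<1+n → sym (longerRow a (ℕₚ.≤-pred a<1+n)))) ⟩
    Σ (suc n) row′ + row′ (suc n) ∎
    where
      row row′ : ℕ → Carrier
      row  a = Σ (suc (n ∸ a)) (λ b → F (a ℕ.+ b) a)
      row′ a = Σ (suc (suc n ∸ a)) (λ b → F (a ℕ.+ b) a)
      longerRow : ∀ a → a ≤ n → row′ a ≈ row a + F (suc n) a
      longerRow a a≤n = begin
        row′ a                  ≡⟨ ≡.cong (λ k → Σ (suc k) (λ b → F (a ℕ.+ b) a)) (ℕₚ.+-∸-assoc 1 a≤n) ⟩
        row a + F (a ℕ.+ suc (n ∸ a)) a
          ≡⟨ ≡.cong (λ k → row a + F k a) (≡.trans (ℕₚ.+-suc a (n ∸ a)) (≡.cong suc (ℕₚ.m+[n∸m]≡n a≤n))) ⟩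
        row a + F (suc n) a     ∎
      lastRow : row′ (suc n) ≈ F (suc n) (suc n)
      lastRow rewrite ℕₚ.n∸n≡0 n | ℕₚ.+-identityʳ n = +-identityˡ _

module NaturalEmbedding {c ℓ : Level} (S : CommutativeRing c ℓ) where
  open CommutativeRing S hiding (zero)
  open import Relation.Binary.Reasoning.Setoid setoid
  open import Algebra.Properties.Semiring.Exp semiring using (_^_)
  open import Algebra.Properties.Ring ring using (-‿distribˡ-*; -1*x≈-x)

  ι-+ : ∀ a b → ι S (a ℕ.+ b) ≈ ι S a + ι S b
  ι-+ zero    b = sym (+-identityˡ _)
  ι-+ (suc a) b = trans (+-congˡ (ι-+ a b)) (sym (+-assoc _ _ _))

  ι-* : ∀ a b → ι S (a ℕ.* b) ≈ ι S a * ι S b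
  ι-* zero    b = sym (zeroˡ _)
  ι-* (suc a) b = begin
    ι S (b ℕ.+ a ℕ.* b)              ≈⟨ ι-+ b (a ℕ.* b) ⟩
    ι S b + ι S (a ℕ.* b)            ≈⟨ +-cong (sym (*-identityˡ _)) (ι-* a b) ⟩
    1# * ι S b + ι S a * ι S b       ≈⟨ sym (distribʳ _ _ _) ⟩
    (1# + ι S a) * ι S b             ∎

  ι-^ : ∀ a k → ι S (a ℕ.^ k) ≈ ι S a ^ k
  ι-^ a zero    = +-identityʳ _
  ι-^ a (suc k) = trans (ι-* a (a ℕ.^ k)) (*-congˡ (ι-^ a k))

  sgn-+ : ∀ a b → sgn S (a ℕ.+ b) ≈ sgn S a * sgn S b
  sgn-+ zero    b = sym (*-identityˡ _)
  sgn-+ (suc a) b = trans (-‿cong (sgn-+ a b)) (-‿distribˡ-* _ _)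

  sgn≈-1^ : ∀ n → sgn S n ≈ (- 1#) ^ n
  sgn≈-1^ zero    = refl
  sgn≈-1^ (suc n) = trans (-‿cong (sgn≈-1^ n)) (sym (-1*x≈-x _))

module FiniteField {c ℓ : Level} (R : CommutativeRing c ℓ) (q : ℕ) (𝔽 : IsFiniteField R q) where
  open CommutativeRing R hiding (zero)
  open IsFiniteField 𝔽
  open NaturalEmbedding R using (ι-^)
  open import Relation.Binary.Reasoning.Setoid setoid
  open import Algebra.Properties.Semiring.Exp semiring using (_^_; ^-congˡ; ^-assocʳ)
  open import Algebra.Properties.Ring ring using (+-identityʳ-unique)
  import Algebra.Properties.CommutativeMonoid.Sum as CommutativeMonoidSum
  open import Data.Fin as Fin using (Fin)
  open import Algebra.Definitions.RawMonoid +-rawMonoid using (_×_)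
  open import Data.Fin.Permutation using (Permutation′; permutation)
  open import Data.Product using (proj₁; proj₂)
  open import Relation.Nullary using (Dec; does)
  private
    module Additive       = CommutativeMonoidSum +-commutativeMonoid
    module Multiplicative = CommutativeMonoidSum *-commutativeMonoid

  index : Carrier → Fin q
  index x = proj₁ (enum-surj x)

  enum-index : ∀ x → enum (index x) ≈ x
  enum-index x = proj₂ (enum-surj x)

  index-cong : ∀ {x y} → x ≈ y → index x ≡ index y
  index-cong {x} {y} x≈y = enum-inj _ _ (trans (enum-index x) (trans x≈y (sym (enum-index y))))

  _≈?_ : ∀ x y → Dec (x ≈ y)
  x ≈? y with index x Fin.≟ index y
  ... | yes i≡j = yes (trans (sym (enum-index x)) (trans (reflexive (≡.cong enum i≡j)) (enum-index y)))
  ... | no  i≢j = no (λ x≈y → i≢j (index-cong x≈y))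

  *-cancelˡ-nonzero : ∀ {x y z} → ¬ x ≈ 0# → x * y ≈ x * z → y ≈ z
  *-cancelˡ-nonzero {x} {y} {z} x≉0 xy≈xz = begin
    y                 ≈⟨ sym (cancel y) ⟩
    x⁻¹ * (x * y)     ≈⟨ *-congˡ xy≈xz ⟩
    x⁻¹ * (x * z)     ≈⟨ cancel z ⟩
    z                 ∎
    where
      x⁻¹ : Carrier
      x⁻¹ = proj₁ (inverse x x≉0)
      cancel : ∀ w → x⁻¹ * (x * w) ≈ w
      cancel w = trans (sym (*-assoc _ _ _))
        (trans (*-congʳ (trans (*-comm _ _) (proj₂ (inverse x x≉0)))) (*-identityˡ w))

  nonzero-* : ∀ {x y} → ¬ x ≈ 0# → ¬ y ≈ 0# → ¬ x * y ≈ 0#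
  nonzero-* x≉0 y≉0 xy≈0 = y≉0 (*-cancelˡ-nonzero x≉0 (trans xy≈0 (sym (zeroʳ _))))

  ^≈0⇒≈0 : ∀ x k → x ^ k ≈ 0# → x ≈ 0#
  ^≈0⇒≈0 x zero    1≈0   = ⊥-elim (1≉0 1≈0)
  ^≈0⇒≈0 x (suc k) xᵏ⁺¹≈0 with x ≈? 0#
  ... | yes x≈0 = x≈0
  ... | no  x≉0 = ⊥-elim (nonzero-* x≉0 (λ xᵏ≈0 → x≉0 (^≈0⇒≈0 x k xᵏ≈0)) xᵏ⁺¹≈0)

  relabel : (Carrier → Carrier) → Fin q → Fin q
  relabel φ i = index (φ (enum i))

  relabel-inverse : ∀ {φ ψ} → (∀ {x y} → x ≈ y → φ x ≈ φ y) → (∀ x → φ (ψ x) ≈ x) →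
                    ∀ i → relabel φ (relabel ψ i) ≡ i
  relabel-inverse φ-cong φψ≈id i =
    enum-inj _ _ (trans (enum-index _) (trans (φ-cong (enum-index _)) (φψ≈id (enum i))))

  relabelling : ∀ φ ψ → (∀ {x y} → x ≈ y → φ x ≈ φ y) → (∀ {x y} → x ≈ y → ψ x ≈ ψ y) →
                (∀ x → φ (ψ x) ≈ x) → (∀ x → ψ (φ x) ≈ x) → Permutation′ q
  relabelling φ ψ φ-cong ψ-cong φψ≈id ψφ≈id =
    permutation (relabel φ) (relabel ψ) (relabel-inverse φ-cong φψ≈id) (relabel-inverse ψ-cong ψφ≈id)

  -- Translation by 1 permutes R, so Σ x = Σ (x + 1) = Σ x + q.
  ι-q≈0 : ι R q ≈ 0#
  ι-q≈0 = +-identityʳ-unique (Additive.sum enum) (ι R q) (sym (begin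
    Additive.sum enum                                 ≈⟨ Additive.sum-permute {q} enum translation ⟩
    Additive.sum (λ i → enum (relabel (_+ 1#) i))     ≈⟨ Additive.sum-cong-≋ {q} (λ i → enum-index _) ⟩
    Additive.sum (λ i → enum i + 1#)                  ≈⟨ Additive.∑-distrib-+ {q} enum (λ _ → 1#) ⟩
    Additive.sum enum + Additive.sum {q} (λ _ → 1#)   ≈⟨ +-congˡ (Additive.sum-replicate q) ⟩
    Additive.sum enum + q × 1#                        ≈⟨ +-congˡ (×1≈ι q) ⟩
    Additive.sum enum + ι R q                         ∎))
    where
      ×1≈ι : ∀ n → n × 1# ≈ ι R n
      ×1≈ι zero    = refl
      ×1≈ι (suc n) = +-congˡ (×1≈ι n)
      cancel : ∀ x {y z} → y + z ≈ 0# → x + y + z ≈ x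
      cancel x y+z≈0 = trans (+-assoc _ _ _) (trans (+-congˡ y+z≈0) (+-identityʳ x))
      translation : Permutation′ q
      translation = relabelling (_+ 1#) (_+ - 1#) +-congʳ +-congʳ
        (λ x → cancel x (-‿inverseˡ 1#)) (λ x → cancel x (-‿inverseʳ 1#))

  ι-p≈0 : ι R p ≈ 0#
  ι-p≈0 = ^≈0⇒≈0 (ι R p) k (trans (sym (ι-^ p k)) (trans (reflexive (≡.cong (ι R) (≡.sym q≡p^k))) ι-q≈0))

  puncture : ∀ {n} → Fin n → Carrier → Fin n → Carrier
  puncture z d i = if does (i Fin.≟ z) then 1# else d

  puncture-≡ : ∀ {n} {z i : Fin n} d → i ≡ z → puncture z d i ≈ 1#
  puncture-≡ {z = z} {i} d i≡z with i Fin.≟ z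
  ... | yes _   = refl
  ... | no  i≢z = ⊥-elim (i≢z i≡z)

  puncture-≢ : ∀ {n} {z i : Fin n} d → i ≢ z → puncture z d i ≈ d
  puncture-≢ {z = z} {i} d i≢z with i Fin.≟ z
  ... | yes i≡z = ⊥-elim (i≢z i≡z)
  ... | no  _   = refl

  ∏-puncture : ∀ n d (z : Fin n) → Multiplicative.sum (puncture z d) * d ≈ d ^ n
  ∏-puncture (suc n) d Fin.zero = begin
    1# * Multiplicative.sum (λ (_ : Fin n) → d) * d  ≈⟨ *-congʳ (*-identityˡ _) ⟩
    Multiplicative.sum (λ (_ : Fin n) → d) * d       ≈⟨ *-congʳ (Multiplicative.sum-replicate n) ⟩
    d ^ n * d                                        ≈⟨ *-comm _ _ ⟩
    d ^ suc n                                        ∎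
  ∏-puncture (suc n) d (Fin.suc z) = begin
    d * Multiplicative.sum (λ i → puncture (Fin.suc z) d (Fin.suc i)) * d
      ≈⟨ *-assoc _ _ _ ⟩
    d * (Multiplicative.sum (λ i → puncture (Fin.suc z) d (Fin.suc i)) * d)
      ≈⟨ *-congˡ (*-congʳ (Multiplicative.sum-cong-≋ {n} shifted)) ⟩
    d * (Multiplicative.sum (puncture z d) * d)
      ≈⟨ *-congˡ (∏-puncture n d z) ⟩
    d ^ suc n ∎
    where
      shifted : ∀ i → puncture (Fin.suc z) d (Fin.suc i) ≈ puncture z d i
      shifted i with i Fin.≟ z
      ... | yes _ = refl
      ... | no  _ = refl

  z₀ : Fin q
  z₀ = index 0#

  ≡z₀⇒enum≈0 : ∀ {i} → i ≡ z₀ → enum i ≈ 0#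
  ≡z₀⇒enum≈0 ≡.refl = enum-index 0#

  enum≈0⇒≡z₀ : ∀ {i} → enum i ≈ 0# → i ≡ z₀
  enum≈0⇒≡z₀ eᵢ≈0 = enum-inj _ _ (trans eᵢ≈0 (sym (enum-index 0#)))

  nonzeroPart : Fin q → Carrier
  nonzeroPart i = puncture z₀ (enum i) i

  nonzeroPart-nonzero : ∀ i → ¬ nonzeroPart i ≈ 0#
  nonzeroPart-nonzero i with i Fin.≟ z₀
  ... | yes _   = 1≉0
  ... | no  i≢z₀ = λ eᵢ≈0 → i≢z₀ (enum≈0⇒≡z₀ eᵢ≈0)

  ∏-nonzero : ∀ n (f : Fin n → Carrier) → (∀ i → ¬ f i ≈ 0#) → ¬ Multiplicative.sum f ≈ 0#
  ∏-nonzero zero    f f≉0 = 1≉0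
  ∏-nonzero (suc n) f f≉0 = nonzero-* (f≉0 Fin.zero) (∏-nonzero n (λ i → f (Fin.suc i)) (λ i → f≉0 (Fin.suc i)))

  nonzeroPart-scale : ∀ {a} → ¬ a ≈ 0# → ∀ i → nonzeroPart (relabel (a *_) i) ≈ puncture z₀ a i * nonzeroPart i
  nonzeroPart-scale {a} a≉0 i with i Fin.≟ z₀
  ... | yes i≡z₀ = trans (puncture-≡ _ (enum≈0⇒≡z₀ a·eᵢ≈0)) (sym (*-identityˡ 1#))
    where
      a·eᵢ≈0 : enum (relabel (a *_) i) ≈ 0#
      a·eᵢ≈0 = trans (enum-index _) (trans (*-congˡ (≡z₀⇒enum≈0 i≡z₀)) (zeroʳ a))
  ... | no  i≢z₀ = trans (puncture-≢ _ a·eᵢ≢z₀) (enum-index _)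
    where
      a·eᵢ≢z₀ : relabel (a *_) i ≢ z₀
      a·eᵢ≢z₀ a·eᵢ≡z₀ = nonzero-* a≉0 (λ eᵢ≈0 → i≢z₀ (enum≈0⇒≡z₀ eᵢ≈0))
        (trans (sym (enum-index _)) (≡z₀⇒enum≈0 a·eᵢ≡z₀))

  scaling : ∀ {a} → ¬ a ≈ 0# → Permutation′ q
  scaling {a} a≉0 = relabelling (a *_) (a⁻¹ *_) *-congˡ *-congˡ
    (rescale (proj₂ (inverse a a≉0))) (rescale (trans (*-comm _ _) (proj₂ (inverse a a≉0))))
    where
      a⁻¹ : Carrier
      a⁻¹ = proj₁ (inverse a a≉0)
      rescale : ∀ {b c} → b * c ≈ 1# → ∀ x → b * (c * x) ≈ x
      rescale bc≈1 x = trans (sym (*-assoc _ _ _)) (trans (*-congʳ bc≈1) (*-identityˡ x))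

  -- Multiplication by a permutes the nonzero elements, so ∏ nonzeroPart = a^(q-1) ∏ nonzeroPart.
  ∏-puncture≈1 : ∀ {a} → ¬ a ≈ 0# → Multiplicative.sum (puncture z₀ a) ≈ 1#
  ∏-puncture≈1 {a} a≉0 = *-cancelˡ-nonzero (∏-nonzero q nonzeroPart nonzeroPart-nonzero)
    (trans (*-comm _ _) (trans (sym ∏≈∏a*∏) (sym (*-identityʳ _))))
    where
      ∏≈∏a*∏ : Multiplicative.sum nonzeroPart ≈ Multiplicative.sum (puncture z₀ a) * Multiplicative.sum nonzeroPart
      ∏≈∏a*∏ = begin
        Multiplicative.sum nonzeroPart                                 ≈⟨ Multiplicative.sum-permute nonzeroPart (scaling a≉0) ⟩
        Multiplicative.sum (λ i → nonzeroPart (relabel (a *_) i))      ≈⟨ Multiplicative.sum-cong-≋ {q} (nonzeroPart-scale a≉0) ⟩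
        Multiplicative.sum (λ i → puncture z₀ a i * nonzeroPart i)     ≈⟨ Multiplicative.∑-distrib-+ (puncture z₀ a) nonzeroPart ⟩
        Multiplicative.sum (puncture z₀ a) * Multiplicative.sum nonzeroPart ∎

  fermat : ∀ a → a ^ q ≈ a
  fermat a with a ≈? 0#
  ... | yes a≈0 = trans (^-congˡ q a≈0) (trans (0^ z₀) (sym a≈0))
    where
      0^ : ∀ {n} → Fin n → 0# ^ n ≈ 0#
      0^ {suc n} _ = zeroˡ _
  ... | no  a≉0 = begin
    a ^ q                                    ≈⟨ ∏-puncture q a z₀ ⟨
    Multiplicative.sum (puncture z₀ a) * a   ≈⟨ *-congʳ (∏-puncture≈1 a≉0) ⟩
    1# * a                                   ≈⟨ *-identityˡ a ⟩
    a                                        ∎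

  fermat-^ : ∀ a t → a ^ (q ℕ.^ t) ≈ a
  fermat-^ a zero    = *-identityʳ a
  fermat-^ a (suc t) = begin
    a ^ (q ℕ.* q ℕ.^ t)     ≈⟨ sym (^-assocʳ a q (q ℕ.^ t)) ⟩
    (a ^ q) ^ (q ℕ.^ t)     ≈⟨ ^-congˡ (q ℕ.^ t) (fermat a) ⟩
    a ^ (q ℕ.^ t)           ≈⟨ fermat-^ a t ⟩
    a                       ∎

module Binomial where
  open import Data.Nat using (_+_; _*_; _^_; _!)
  open import Data.Nat.Combinatorics using (_C_; k>n⇒nCk≡0; nCk≡n!/k![n-k]!; k![n∸k]!∣n!)
  open import Data.Nat.DivMod using (m/n*n≡m)
  open import Data.Nat.Divisibility using (_∣_; divides; _∣?_)
  open import Data.Nat.Primality using (euclidsLemma)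
  open import Data.Nat.Tactic.RingSolver using (solve-∀)
  open ≡.≡-Reasoning

  C-factorial : ∀ {n k} → k ≤ n → (n C k) * (k ! * (n ∸ k) !) ≡ n !
  C-factorial {n} {k} k≤n = ≡.trans (≡.cong (_* (k ! * (n ∸ k) !)) (nCk≡n!/k![n-k]! k≤n))
    (m/n*n≡m {{ℕₚ._!*_!≢0 k (n ∸ k)}} (k![n∸k]!∣n! k≤n))

  C-absorption : ∀ n k → suc k * (suc n C suc k) ≡ suc n * (n C k)
  C-absorption n k with k ℕₚ.≤? n
  ... | no  k≰n = ≡.trans (≡.cong (suc k *_) (k>n⇒nCk≡0 (s≤s (ℕₚ.≰⇒> k≰n))))
                    (≡.trans (ℕₚ.*-zeroʳ (suc k)) (≡.sym (≡.trans (≡.cong (suc n *_) (k>n⇒nCk≡0 (ℕₚ.≰⇒> k≰n))) (ℕₚ.*-zeroʳ (suc n)))))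
  ... | yes k≤n = ℕₚ.*-cancelʳ-≡ _ _ (k ! * (n ∸ k) !) {{ℕₚ._!*_!≢0 k (n ∸ k)}} (begin
    suc k * (suc n C suc k) * (k ! * (n ∸ k) !)     ≡⟨ rearrange (suc k) (suc n C suc k) (k !) ((n ∸ k) !) ⟩
    (suc n C suc k) * (suc k ! * (suc n ∸ suc k) !) ≡⟨ C-factorial (s≤s k≤n) ⟩
    suc n !                                         ≡⟨ ≡.cong (suc n *_) (C-factorial k≤n) ⟨
    suc n * ((n C k) * (k ! * (n ∸ k) !))           ≡⟨ ℕₚ.*-assoc (suc n) (n C k) _ ⟨
    suc n * (n C k) * (k ! * (n ∸ k) !)             ∎)
    where
      rearrange : ∀ a b c d → a * b * (c * d) ≡ b * (a * c * d)
      rearrange = solve-∀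

  C-subset : ∀ r d j → ((r + d) C (r + j)) * ((r + j) C r) ≡ ((r + d) C r) * (d C j)
  C-subset r d j with j ℕₚ.≤? d
  ... | no  j≰d = ≡.trans (≡.cong (_* ((r + j) C r)) (k>n⇒nCk≡0 (ℕₚ.+-monoʳ-< r (ℕₚ.≰⇒> j≰d))))
                    (≡.sym (≡.trans (≡.cong (((r + d) C r) *_) (k>n⇒nCk≡0 (ℕₚ.≰⇒> j≰d))) (ℕₚ.*-zeroʳ ((r + d) C r))))
  ... | yes j≤d = ℕₚ.*-cancelʳ-≡ _ _ (r ! * (j ! * (d ∸ j) !)) {{ℕₚ.m*n≢0 _ _ {{ℕₚ._!≢0 r}} {{ℕₚ._!*_!≢0 j (d ∸ j)}}}}
                    (≡.trans lhs≡ (≡.sym rhs≡))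
    where
      A B : ℕ
      A = (r + d) C (r + j)
      B = (r + j) C r
      regroupˡ : ∀ a b x y z → a * b * (x * (y * z)) ≡ a * (b * (x * y)) * z
      regroupˡ = solve-∀
      regroupʳ : ∀ a b x y z → a * b * (x * (y * z)) ≡ a * (x * (b * (y * z)))
      regroupʳ = solve-∀
      lhs≡ : A * B * (r ! * (j ! * (d ∸ j) !)) ≡ (r + d) !
      lhs≡ = begin
        A * B * (r ! * (j ! * (d ∸ j) !))                   ≡⟨ regroupˡ A B (r !) (j !) ((d ∸ j) !) ⟩
        A * (B * (r ! * j !)) * (d ∸ j) !                   ≡⟨ ≡.cong (λ z → A * (B * (r ! * z !)) * (d ∸ j) !) (ℕₚ.m+n∸m≡n r j) ⟨
        A * (B * (r ! * (r + j ∸ r) !)) * (d ∸ j) !         ≡⟨ ≡.cong (λ z → A * z * (d ∸ j) !) (C-factorial (ℕₚ.m≤m+n r j)) ⟩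
        A * (r + j) ! * (d ∸ j) !                           ≡⟨ ℕₚ.*-assoc A _ _ ⟩
        A * ((r + j) ! * (d ∸ j) !)                         ≡⟨ ≡.cong (λ z → A * ((r + j) ! * z !)) (ℕₚ.[m+n]∸[m+o]≡n∸o r d j) ⟨
        A * ((r + j) ! * (r + d ∸ (r + j)) !)               ≡⟨ C-factorial (ℕₚ.+-monoʳ-≤ r j≤d) ⟩
        (r + d) !                                           ∎
      rhs≡ : ((r + d) C r) * (d C j) * (r ! * (j ! * (d ∸ j) !)) ≡ (r + d) !
      rhs≡ = begin
        ((r + d) C r) * (d C j) * (r ! * (j ! * (d ∸ j) !))   ≡⟨ regroupʳ ((r + d) C r) (d C j) (r !) (j !) ((d ∸ j) !) ⟩
        ((r + d) C r) * (r ! * ((d C j) * (j ! * (d ∸ j) !))) ≡⟨ ≡.cong (λ z → ((r + d) C r) * (r ! * z)) (C-factorial j≤d) ⟩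
        ((r + d) C r) * (r ! * d !)                           ≡⟨ ≡.cong (λ z → ((r + d) C r) * (r ! * z !)) (ℕₚ.m+n∸m≡n r d) ⟨
        ((r + d) C r) * (r ! * (r + d ∸ r) !)                 ≡⟨ C-factorial (ℕₚ.m≤m+n r d) ⟩
        (r + d) !                                             ∎

  module _ {p : ℕ} (p-prime : Prime p) where
    private
      instance
        p≢0 : NonZero p
        p≢0 = prime⇒nonZero p-prime
      rotate : ∀ a b c → a * b * c ≡ b * c * a
      rotate = solve-∀
      swap : ∀ a b c → b * (a * c) ≡ a * b * c
      swap = solve-∀

    -- n < p^e cannot absorb all e factors of p.
    prime∣-cofactor : ∀ e n X Y → 0 < n → n < p ^ e → n * X ≡ p ^ e * Y → p ∣ X
    prime∣-cofactor zero n X Y 0<n n<1 _ = ⊥-elim (ℕₚ.<-irrefl ≡.refl (ℕₚ.<-≤-trans 0<n (ℕₚ.≤-pred n<1)))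
    prime∣-cofactor (suc e) n X Y 0<n n<pᵉ⁺¹ nX≡pᵉ⁺¹Y with p ∣? n
    ... | no p∤n with euclidsLemma n X p-prime (divides (p ^ e * Y) (≡.trans nX≡pᵉ⁺¹Y (rotate p (p ^ e) Y)))
    ...   | inj₁ p∣n = ⊥-elim (p∤n p∣n)
    ...   | inj₂ p∣X = p∣X
    prime∣-cofactor (suc e) n X Y 0<n n<pᵉ⁺¹ nX≡pᵉ⁺¹Y | yes (divides n′ ≡.refl) =
      prime∣-cofactor e n′ X Y (0<n′ n′ 0<n) n′<pᵉ
        (ℕₚ.*-cancelˡ-≡ _ _ p (≡.trans (swap n′ p X) (≡.trans nX≡pᵉ⁺¹Y (ℕₚ.*-assoc p (p ^ e) Y))))
      where
        0<n′ : ∀ m → 0 < m * p → 0 < m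
        0<n′ (suc m) _ = s≤s z≤n
        n′<pᵉ : n′ < p ^ e
        n′<pᵉ = ℕₚ.*-cancelʳ-< p n′ (p ^ e) (≡.subst (n′ * p <_) (ℕₚ.*-comm p (p ^ e)) n<pᵉ⁺¹)

    prime∣C-prime-power : ∀ e n → 0 < n → n < p ^ e → p ∣ (p ^ e) C n
    prime∣C-prime-power e (suc k) 0<n n<pᵉ =
      prime∣-cofactor e (suc k) ((p ^ e) C suc k) (N C k) 0<n n<pᵉ
        (≡.subst (λ M → suc k * (M C suc k) ≡ M * (N C k)) (≡.sym pᵉ≡1+N) (C-absorption N k))
      where
        N : ℕ
        N = p ^ e ∸ 1
        pᵉ≡1+N : p ^ e ≡ suc N
        pᵉ≡1+N = ≡.sym (ℕₚ.suc-pred (p ^ e) {{ℕₚ.m^n≢0 p e}})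

module BinomialSums {c ℓ : Level} (S : CommutativeRing c ℓ) where
  open CommutativeRing S hiding (zero)
  open Sums S
  open NaturalEmbedding S
  open Binomial using (C-subset)
  open import Relation.Binary.Reasoning.Setoid setoid
  open import Algebra.Properties.Semiring.Exp semiring using (_^_)
  open import Algebra.Properties.Ring ring using (-‿distribˡ-*)
  open import Algebra.Definitions.RawMonoid +-rawMonoid using (_×_)
  import Algebra.Properties.Monoid.Sum +-monoid as MonoidSum
  import Algebra.Properties.CommutativeSemiring.Binomial commutativeSemiring as BinomialTheorem
  open import Data.Nat.Combinatorics using (_C_; nCk+nC[k+1]≡[n+1]C[k+1]; k>n⇒nCk≡0; nCn≡1)
  open import Data.Fin using (toℕ)
  open import Relation.Binary.Definitions using (tri<; tri≈; tri>)

  ×≈ι* : ∀ n u → n × u ≈ ι S n * u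
  ×≈ι* zero    u = sym (zeroˡ u)
  ×≈ι* (suc n) u = trans (+-cong (sym (*-identityˡ u)) (×≈ι* n u)) (sym (distribʳ _ _ _))

  sum-toℕ : ∀ n (g : ℕ → Carrier) → MonoidSum.sum {n} (λ i → g (toℕ i)) ≈ Σ n g
  sum-toℕ zero    g = refl
  sum-toℕ (suc n) g = trans (+-congˡ (sum-toℕ n (λ i → g (suc i)))) (sym (Σ-suc n g))

  binomial : ∀ n x y → (x + y) ^ n ≈ Σ (suc n) (λ k → ι S (n C k) * (x ^ k * y ^ (n ∸ k)))
  binomial n x y = begin
    (x + y) ^ n                                                             ≈⟨ BinomialTheorem.theorem n x y ⟩
    BinomialTheorem.binomialExpansion x y n                                 ≈⟨ MonoidSum.sum-cong-≋ {suc n} (λ i → ×≈ι* (n C toℕ i) (term (toℕ i))) ⟩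
    MonoidSum.sum {suc n} (λ i → ι S (n C toℕ i) * term (toℕ i))            ≈⟨ sum-toℕ (suc n) (λ k → ι S (n C k) * term k) ⟩
    Σ (suc n) (λ k → ι S (n C k) * (x ^ k * y ^ (n ∸ k)))                   ∎
    where
      term : ℕ → Carrier
      term k = x ^ k * y ^ (n ∸ k)

  binomial-extremes : ∀ N x y → (∀ k → 0 < k → k < suc N → ι S (suc N C k) ≈ 0#) →
                      (x + y) ^ suc N ≈ x ^ suc N + y ^ suc N
  binomial-extremes N x y interior≈0 = begin
    (x + y) ^ suc N                                   ≈⟨ binomial (suc N) x y ⟩
    Σ (suc N) term + term (suc N)                     ≈⟨ +-congʳ (Σ-suc N term) ⟩
    term 0 + Σ N (λ k → term (suc k)) + term (suc N)  ≈⟨ +-congʳ (+-congˡ (Σ-zero N interior)) ⟩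
    term 0 + 0# + term (suc N)                        ≈⟨ +-congʳ (+-identityʳ _) ⟩
    term 0 + term (suc N)                             ≈⟨ +-comm _ _ ⟩
    term (suc N) + term 0                             ≈⟨ +-cong last first ⟩
    x ^ suc N + y ^ suc N                             ∎
    where
      term : ℕ → Carrier
      term k = ι S (suc N C k) * (x ^ k * y ^ (suc N ∸ k))
      interior : ∀ k → k < N → term (suc k) ≈ 0#
      interior k k<N = trans (*-congʳ (interior≈0 (suc k) (s≤s z≤n) (s≤s k<N))) (zeroˡ _)
      first : term 0 ≈ y ^ suc N
      first = trans (*-congʳ (+-identityʳ 1#)) (trans (*-identityˡ _) (*-identityˡ _))
      last : term (suc N) ≈ x ^ suc N
      last = begin
        ι S (suc N C suc N) * (x ^ suc N * y ^ (N ∸ N))  ≡⟨ ≡.cong₂ (λ a b → ι S a * (x ^ suc N * y ^ b)) (nCn≡1 (suc N)) (ℕₚ.n∸n≡0 N) ⟩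
        (1# + 0#) * (x ^ suc N * 1#)                     ≈⟨ *-cong (+-identityʳ 1#) (*-identityʳ _) ⟩
        1# * x ^ suc N                                   ≈⟨ *-identityˡ _ ⟩
        x ^ suc N                                        ∎

  Σ-alternating : ∀ d → Σ (suc (suc d)) (λ j → sgn S j * ι S (suc d C j)) ≈ 0#
  Σ-alternating d = begin
    Σ (suc (suc d)) (λ j → sgn S j * ι S (suc d C j))           ≈⟨ Σ-suc (suc d) _ ⟩
    f 0 + Σ (suc d) (λ j → sgn S (suc j) * ι S (suc d C suc j)) ≈⟨ +-congˡ (Σ-cong′ (suc d) pascal) ⟩
    f 0 + Σ (suc d) (λ j → - f j + f (suc j))                   ≈⟨ +-congˡ (Σ-telescope (suc d) f) ⟩
    f 0 + (- f 0 + f (suc d))                                   ≈⟨ +-assoc _ _ _ ⟨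
    f 0 - f 0 + f (suc d)                                       ≈⟨ +-cong (-‿inverseʳ _) last≈0 ⟩
    0# + 0#                                                     ≈⟨ +-identityˡ 0# ⟩
    0#                                                          ∎
    where
      f : ℕ → Carrier
      f j = sgn S j * ι S (d C j)
      last≈0 : f (suc d) ≈ 0#
      last≈0 = trans (*-congˡ (reflexive (≡.cong (ι S) (k>n⇒nCk≡0 (ℕₚ.n<1+n d))))) (zeroʳ _)
      pascal : ∀ j → sgn S (suc j) * ι S (suc d C suc j) ≈ - f j + f (suc j)
      pascal j = begin
        - sgn S j * ι S (suc d C suc j)                      ≡⟨ ≡.cong (λ k → - sgn S j * ι S k) (nCk+nC[k+1]≡[n+1]C[k+1] d j) ⟨
        - sgn S j * ι S (d C j ℕ.+ d C suc j)                ≈⟨ *-congˡ (ι-+ (d C j) (d C suc j)) ⟩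
        - sgn S j * (ι S (d C j) + ι S (d C suc j))          ≈⟨ distribˡ _ _ _ ⟩
        - sgn S j * ι S (d C j) + - sgn S j * ι S (d C suc j) ≈⟨ +-congʳ (sym (-‿distribˡ-* _ _)) ⟩
        - f j + f (suc j)                                    ∎

  inversionTerm : ℕ → ℕ → ℕ → Carrier
  inversionTerm b r n = if n ℕ.<ᵇ r then 0# else sgn S (n ∸ r) * ι S (n C r) * ι S (b C n)

  inversionTerm-< : ∀ {b r n} → n < r → inversionTerm b r n ≈ 0#
  inversionTerm-< n<r rewrite <ᵇ-true n<r = refl

  inversionTerm-≥ : ∀ {b r n} → r ≤ n → inversionTerm b r n ≈ sgn S (n ∸ r) * ι S (n C r) * ι S (b C n)
  inversionTerm-≥ r≤n rewrite <ᵇ-false (ℕₚ.≤⇒≯ r≤n) = refl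

  Σ-inversion-+ : ∀ r d → Σ (suc (r ℕ.+ d)) (inversionTerm (r ℕ.+ d) r)
                           ≈ ι S ((r ℕ.+ d) C r) * Σ (suc d) (λ j → sgn S j * ι S (d C j))
  Σ-inversion-+ r d = begin
    Σ (suc (r ℕ.+ d)) (inversionTerm (r ℕ.+ d) r)
      ≡⟨ ≡.cong (λ k → Σ k (inversionTerm (r ℕ.+ d) r)) (ℕₚ.+-suc r d) ⟨
    Σ (r ℕ.+ suc d) (inversionTerm (r ℕ.+ d) r)
      ≈⟨ Σ-+ r (suc d) _ ⟩
    Σ r (inversionTerm (r ℕ.+ d) r) + Σ (suc d) (λ j → inversionTerm (r ℕ.+ d) r (r ℕ.+ j))
      ≈⟨ +-congʳ (Σ-zero r (λ n → inversionTerm-<)) ⟩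
    0# + Σ (suc d) (λ j → inversionTerm (r ℕ.+ d) r (r ℕ.+ j))
      ≈⟨ +-identityˡ _ ⟩
    Σ (suc d) (λ j → inversionTerm (r ℕ.+ d) r (r ℕ.+ j))
      ≈⟨ Σ-cong′ (suc d) term ⟩
    Σ (suc d) (λ j → ι S ((r ℕ.+ d) C r) * (sgn S j * ι S (d C j)))
      ≈⟨ *-distribˡ-Σ (suc d) _ _ ⟨
    ι S ((r ℕ.+ d) C r) * Σ (suc d) (λ j → sgn S j * ι S (d C j)) ∎
    where
      term : ∀ j → inversionTerm (r ℕ.+ d) r (r ℕ.+ j) ≈ ι S ((r ℕ.+ d) C r) * (sgn S j * ι S (d C j))
      term j = begin
        inversionTerm (r ℕ.+ d) r (r ℕ.+ j)
          ≈⟨ inversionTerm-≥ (ℕₚ.m≤m+n r j) ⟩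
        sgn S (r ℕ.+ j ∸ r) * ι S ((r ℕ.+ j) C r) * ι S ((r ℕ.+ d) C (r ℕ.+ j))
          ≡⟨ ≡.cong (λ k → sgn S k * ι S ((r ℕ.+ j) C r) * ι S ((r ℕ.+ d) C (r ℕ.+ j))) (ℕₚ.m+n∸m≡n r j) ⟩
        sgn S j * ι S ((r ℕ.+ j) C r) * ι S ((r ℕ.+ d) C (r ℕ.+ j))
          ≈⟨ *-assoc _ _ _ ⟩
        sgn S j * (ι S ((r ℕ.+ j) C r) * ι S ((r ℕ.+ d) C (r ℕ.+ j)))
          ≈⟨ *-congˡ (trans (*-comm _ _) (sym (ι-* ((r ℕ.+ d) C (r ℕ.+ j)) ((r ℕ.+ j) C r)))) ⟩
        sgn S j * ι S (((r ℕ.+ d) C (r ℕ.+ j)) ℕ.* ((r ℕ.+ j) C r))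
          ≡⟨ ≡.cong (λ k → sgn S j * ι S k) (C-subset r d j) ⟩
        sgn S j * ι S (((r ℕ.+ d) C r) ℕ.* (d C j))
          ≈⟨ *-congˡ (ι-* ((r ℕ.+ d) C r) (d C j)) ⟩
        sgn S j * (ι S ((r ℕ.+ d) C r) * ι S (d C j))
          ≈⟨ x∙yz≈y∙xz _ _ _ ⟩
        ι S ((r ℕ.+ d) C r) * (sgn S j * ι S (d C j)) ∎
        where open import Algebra.Properties.CommutativeSemigroup *-commutativeSemigroup using (x∙yz≈y∙xz)

  Σ-inversion-diag : ∀ r → Σ (suc r) (inversionTerm r r) ≈ 1#
  Σ-inversion-diag r = begin
    Σ (suc r) (inversionTerm r r)                          ≡⟨ ≡.cong (λ k → Σ (suc k) (inversionTerm k r)) (ℕₚ.+-identityʳ r) ⟨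
    Σ (suc (r ℕ.+ 0)) (inversionTerm (r ℕ.+ 0) r)          ≈⟨ Σ-inversion-+ r 0 ⟩
    ι S ((r ℕ.+ 0) C r) * (0# + 1# * (1# + 0#))            ≡⟨ ≡.cong (λ k → ι S (k C r) * _) (ℕₚ.+-identityʳ r) ⟩
    ι S (r C r) * (0# + 1# * (1# + 0#))                    ≡⟨ ≡.cong (λ k → ι S k * _) (nCn≡1 r) ⟩
    (1# + 0#) * (0# + 1# * (1# + 0#))                      ≈⟨ *-cong (+-identityʳ 1#) (trans (+-identityˡ _) (trans (*-identityˡ _) (+-identityʳ 1#))) ⟩
    1# * 1#                                                ≈⟨ *-identityˡ 1# ⟩
    1#                                                     ∎

  Σ-inversion-off : ∀ b r → b ≢ r → Σ (suc b) (inversionTerm b r) ≈ 0#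
  Σ-inversion-off b r b≢r with ℕₚ.<-cmp b r
  ... | tri< b<r _ _ = Σ-zero (suc b) (λ n n<1+b → inversionTerm-< (ℕₚ.<-≤-trans n<1+b b<r))
  ... | tri≈ _ b≡r _ = ⊥-elim (b≢r b≡r)
  ... | tri> _ _ r<b = ≡.subst (λ k → Σ (suc k) (inversionTerm k r) ≈ 0#) (ℕₚ.m+[n∸m]≡n (ℕₚ.<⇒≤ r<b))
          (trans (Σ-inversion-+ r (b ∸ r)) (trans (*-congˡ alternating) (zeroʳ _)))
    where
      alternating : Σ (suc (b ∸ r)) (λ j → sgn S j * ι S ((b ∸ r) C j)) ≈ 0#
      alternating = ≡.subst (λ k → Σ (suc k) (λ j → sgn S j * ι S (k C j)) ≈ 0#)
                      (≡.sym (ℕₚ.+-∸-assoc 1 r<b)) (Σ-alternating (b ∸ suc r))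

module Frobenius {c ℓ : Level} (S : CommutativeRing c ℓ) {p : ℕ} (p-prime : Prime p)
                 (ι-p≈0 : CommutativeRing._≈_ S (ι S p) (CommutativeRing.0# S)) where
  open CommutativeRing S hiding (zero)
  open Sums S
  open NaturalEmbedding S
  open BinomialSums S using (binomial-extremes)
  open Binomial using (prime∣C-prime-power)
  open import Relation.Binary.Reasoning.Setoid setoid
  open import Algebra.Properties.Semiring.Exp semiring using (_^_; ^-congˡ)
  open import Algebra.Properties.Ring ring using (+-inverseʳ-unique)
  open import Data.Nat.Combinatorics using (_C_)
  open import Data.Nat.Divisibility using (divides)

  ι-C-prime-power≈0 : ∀ e n → 0 < n → n < p ℕ.^ e → ι S ((p ℕ.^ e) C n) ≈ 0#
  ι-C-prime-power≈0 e n 0<n n<pᵉ with prime∣C-prime-power p-prime e n 0<n n<pᵉ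
  ... | divides w pᵉCn≡w*p = trans (reflexive (≡.cong (ι S) pᵉCn≡w*p)) (trans (ι-* w p) (trans (*-congˡ ι-p≈0) (zeroʳ _)))

  pᵉ≡suc-pred : ∀ e → p ℕ.^ e ≡ suc (p ℕ.^ e ∸ 1)
  pᵉ≡suc-pred e = ≡.sym (ℕₚ.suc-pred (p ℕ.^ e) {{ℕₚ.m^n≢0 p e {{prime⇒nonZero p-prime}}}})

  frobenius : ∀ e x y → (x + y) ^ (p ℕ.^ e) ≈ x ^ (p ℕ.^ e) + y ^ (p ℕ.^ e)
  frobenius e x y = ≡.subst (λ M → (x + y) ^ M ≈ x ^ M + y ^ M) (≡.sym (pᵉ≡suc-pred e))
    (binomial-extremes (p ℕ.^ e ∸ 1) x y (λ k 0<k k<pᵉ → ≡.subst (λ M → ι S (M C k) ≈ 0#) (pᵉ≡suc-pred e)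
      (ι-C-prime-power≈0 e k 0<k (≡.subst (k <_) (≡.sym (pᵉ≡suc-pred e)) k<pᵉ))))

  0^pᵉ≈0 : ∀ e → 0# ^ (p ℕ.^ e) ≈ 0#
  0^pᵉ≈0 e = ≡.subst (λ M → 0# ^ M ≈ 0#) (≡.sym (pᵉ≡suc-pred e)) (zeroˡ _)

  frobenius-Σ : ∀ e n f → Σ n f ^ (p ℕ.^ e) ≈ Σ n (λ i → f i ^ (p ℕ.^ e))
  frobenius-Σ e zero    f = 0^pᵉ≈0 e
  frobenius-Σ e (suc n) f = trans (frobenius e _ _) (+-congʳ (frobenius-Σ e n f))

  sgn-pᵉ : ∀ e → sgn S (p ℕ.^ e) ≈ - 1#
  sgn-pᵉ e = trans (sgn≈-1^ (p ℕ.^ e)) (+-inverseʳ-unique 1# _ (begin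
    1# + (- 1#) ^ (p ℕ.^ e)                 ≈⟨ +-congʳ (sym (1^ (p ℕ.^ e))) ⟩
    1# ^ (p ℕ.^ e) + (- 1#) ^ (p ℕ.^ e)     ≈⟨ sym (frobenius e 1# (- 1#)) ⟩
    (1# + - 1#) ^ (p ℕ.^ e)                 ≈⟨ ^-congˡ (p ℕ.^ e) (-‿inverseʳ 1#) ⟩
    0# ^ (p ℕ.^ e)                          ≈⟨ 0^pᵉ≈0 e ⟩
    0#                                      ∎))
    where
      1^ : ∀ n → 1# ^ n ≈ 1#
      1^ zero    = refl
      1^ (suc n) = trans (*-identityˡ _) (1^ n)

module PowerSeries {c ℓ : Level} (R : CommutativeRing c ℓ) where
  open CommutativeRing R hiding (zero)
  open Sums R
  open import Data.Nat.Combinatorics using (_C_; k>n⇒nCk≡0)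
  open import Algebra.Structures using (IsCommutativeRing)

  infix  4 _≈ᴾ_
  infixl 6 _+ᴾ_
  infixl 7 _*ᴾ_

  _≈ᴾ_ : PS R → PS R → Set ℓ
  _≈ᴾ_ = _≈ₚ_ R

  _+ᴾ_ _*ᴾ_ : PS R → PS R → PS R
  _+ᴾ_ = _+ₚ_ R
  _*ᴾ_ = _*ₚ_ R

  -ᴾ_ : PS R → PS R
  (-ᴾ f) n = - f n

  *ᴾ-cong : ∀ {f f′ g g′} → f ≈ᴾ f′ → g ≈ᴾ g′ → f *ᴾ g ≈ᴾ f′ *ᴾ g′
  *ᴾ-cong f≈f′ g≈g′ n = Σ-cong′ (suc n) (λ i → *-cong (f≈f′ i) (g≈g′ (n ∸ i)))

  *ᴾ-comm : ∀ f g → f *ᴾ g ≈ᴾ g *ᴾ f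
  *ᴾ-comm f g n = trans (Σ-reverse (suc n) _) (Σ-cong (suc n) λ i i<1+n →
    trans (*-comm _ _) (*-congʳ (reflexive (≡.cong g (ℕₚ.m∸[m∸n]≡n (ℕₚ.≤-pred i<1+n))))))

  *ᴾ-identityˡ : ∀ g → oneₚ R *ᴾ g ≈ᴾ g
  *ᴾ-identityˡ g n = trans (Σ-single (suc n) 0 _ (s≤s z≤n) (λ i _ → higher≈0 i)) (*-identityˡ _)
    where
      higher≈0 : ∀ i → i ≢ 0 → oneₚ R i * g (n ∸ i) ≈ 0#
      higher≈0 zero    i≢0 = ⊥-elim (i≢0 ≡.refl)
      higher≈0 (suc i) _   = zeroˡ _

  *ᴾ-distribˡ-+ᴾ : ∀ f g h → f *ᴾ (g +ᴾ h) ≈ᴾ f *ᴾ g +ᴾ f *ᴾ h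
  *ᴾ-distribˡ-+ᴾ f g h n = trans (Σ-cong′ (suc n) (λ i → distribˡ _ _ _)) (Σ-distrib-+ (suc n) _ _)

  *ᴾ-assoc : ∀ f g h → (f *ᴾ g) *ᴾ h ≈ᴾ f *ᴾ (g *ᴾ h)
  *ᴾ-assoc f g h n = begin
    Σ (suc n) (λ i → Σ (suc i) (λ a → f a * g (i ∸ a)) * h (n ∸ i))
      ≈⟨ Σ-cong′ (suc n) (λ i → *-distribʳ-Σ (suc i) _ _) ⟩
    Σ (suc n) (λ i → Σ (suc i) (λ a → f a * g (i ∸ a) * h (n ∸ i)))
      ≈⟨ Σ-triangle n (λ i a → f a * g (i ∸ a) * h (n ∸ i)) ⟩
    Σ (suc n) (λ a → Σ (suc (n ∸ a)) (λ b → f a * g (a ℕ.+ b ∸ a) * h (n ∸ (a ℕ.+ b))))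
      ≈⟨ Σ-cong′ (suc n) (λ a → Σ-cong′ (suc (n ∸ a)) (λ b → reindex a b)) ⟩
    Σ (suc n) (λ a → Σ (suc (n ∸ a)) (λ b → f a * (g b * h (n ∸ a ∸ b))))
      ≈⟨ Σ-cong′ (suc n) (λ a → sym (*-distribˡ-Σ (suc (n ∸ a)) _ _)) ⟩
    Σ (suc n) (λ a → f a * Σ (suc (n ∸ a)) (λ b → g b * h (n ∸ a ∸ b)))
      ∎
    where
      open import Relation.Binary.Reasoning.Setoid setoid
      reindex : ∀ a b → f a * g (a ℕ.+ b ∸ a) * h (n ∸ (a ℕ.+ b)) ≈ f a * (g b * h (n ∸ a ∸ b))
      reindex a b = trans (reflexive (≡.cong₂ (λ u v → f a * g u * h v) (ℕₚ.m+n∸m≡n a b) (≡.sym (ℕₚ.∸-+-assoc n a b))))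
                          (*-assoc _ _ _)

  PS-isCommutativeRing : IsCommutativeRing _≈ᴾ_ _+ᴾ_ _*ᴾ_ -ᴾ_ (zeroₚ R) (oneₚ R)
  PS-isCommutativeRing = record
    { isRing = record
      { +-isAbelianGroup = record
        { isGroup = record
          { isMonoid = record
            { isSemigroup = record
              { isMagma = record
                { isEquivalence = record
                  { refl = λ _ → refl ; sym = λ e n → sym (e n) ; trans = λ e e′ n → trans (e n) (e′ n) }
                ; ∙-cong = λ e e′ n → +-cong (e n) (e′ n) }
              ; assoc = λ f g h n → +-assoc (f n) (g n) (h n) }
            ; identity = (λ f n → +-identityˡ (f n)) , (λ f n → +-identityʳ (f n)) }
          ; inverse = (λ f n → -‿inverseˡ (f n)) , (λ f n → -‿inverseʳ (f n))
          ; ⁻¹-cong = λ e n → -‿cong (e n) }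
        ; comm = λ f g n → +-comm (f n) (g n) }
      ; *-cong = *ᴾ-cong
      ; *-assoc = *ᴾ-assoc
      ; *-identity = *ᴾ-identityˡ , (λ g n → trans (*ᴾ-comm g (oneₚ R) n) (*ᴾ-identityˡ g n))
      ; distrib = *ᴾ-distribˡ-+ᴾ , λ f g h n → trans (*ᴾ-comm (g +ᴾ h) f n)
                    (trans (*ᴾ-distribˡ-+ᴾ f g h n) (+-cong (*ᴾ-comm f g n) (*ᴾ-comm f h n))) }
    ; *-comm = *ᴾ-comm }

  PS-commutativeRing : CommutativeRing c ℓ
  PS-commutativeRing = record { isCommutativeRing = PS-isCommutativeRing }

  private
    module 𝑃 = CommutativeRing PS-commutativeRing

  open import Algebra.Properties.Semiring.Exp semiring using (_^_) public
  open import Algebra.Properties.Semiring.Exp 𝑃.semiring using () renaming (_^_ to _^ᴾ_) public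

  infixr 8 _·_
  infix  9 T^_

  T^_ : ℕ → PS R
  T^_ = Tpow R

  _·_ : Carrier → PS R → PS R
  _·_ = scaleₚ R

  T^-≡ : ∀ {i j} → i ≡ j → (T^ j) i ≈ 1#
  T^-≡ {i} {j} i≡j with i ℕ.≡ᵇ j in eq
  ... | true  = refl
  ... | false = ⊥-elim (≡.subst T eq (ℕₚ.≡⇒≡ᵇ i j i≡j))

  T^-≢ : ∀ {i j} → i ≢ j → (T^ j) i ≈ 0#
  T^-≢ {i} {j} i≢j with i ℕ.≡ᵇ j in eq
  ... | true  = ⊥-elim (i≢j (ℕₚ.≡ᵇ⇒≡ i j (≡.subst T (≡.sym eq) _)))
  ... | false = refl

  T^-*ᴾ : ∀ a b → T^ a *ᴾ T^ b ≈ᴾ T^ (a ℕ.+ b)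
  T^-*ᴾ a b n with a ℕₚ.≤? n
  ... | yes a≤n = begin
    Σ (suc n) (λ i → (T^ a) i * (T^ b) (n ∸ i)) ≈⟨ Σ-single (suc n) a _ (s≤s a≤n) (λ i _ i≢a → trans (*-congʳ (T^-≢ i≢a)) (zeroˡ _)) ⟩
    (T^ a) a * (T^ b) (n ∸ a)                   ≈⟨ trans (*-congʳ (T^-≡ {a} ≡.refl)) (*-identityˡ _) ⟩
    (T^ b) (n ∸ a)                              ≈⟨ shift ⟩
    (T^ (a ℕ.+ b)) n                            ∎
    where
      open import Relation.Binary.Reasoning.Setoid setoid
      shift : (T^ b) (n ∸ a) ≈ (T^ (a ℕ.+ b)) n
      shift with n ∸ a ℕₚ.≟ b
      ... | yes n∸a≡b = trans (T^-≡ n∸a≡b) (sym (T^-≡ (≡.trans (≡.sym (ℕₚ.m+[n∸m]≡n a≤n)) (≡.cong (a ℕ.+_) n∸a≡b))))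
      ... | no  n∸a≢b = trans (T^-≢ n∸a≢b) (sym (T^-≢ (λ n≡a+b → n∸a≢b (≡.trans (≡.cong (_∸ a) n≡a+b) (ℕₚ.m+n∸m≡n a b)))))
  ... | no  a≰n = trans (Σ-zero (suc n) below) (sym (T^-≢ n≢a+b))
    where
      below : ∀ i → i < suc n → (T^ a) i * (T^ b) (n ∸ i) ≈ 0#
      below i i<1+n = trans (*-congʳ (T^-≢ (λ i≡a → a≰n (≡.subst (_≤ n) i≡a (ℕₚ.≤-pred i<1+n))))) (zeroˡ _)
      n≢a+b : n ≢ a ℕ.+ b
      n≢a+b n≡a+b = a≰n (≡.subst (a ≤_) (≡.sym n≡a+b) (ℕₚ.m≤m+n a b))

  ·-cong : ∀ {a b f g} → a ≈ b → f ≈ᴾ g → a · f ≈ᴾ b · g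
  ·-cong a≈b f≈g n = *-cong a≈b (f≈g n)

  ·-zero : ∀ {a} f → a ≈ 0# → a · f ≈ᴾ zeroₚ R
  ·-zero f a≈0 n = trans (*-congʳ a≈0) (zeroˡ _)

  ·-distribʳ : ∀ a b f → (a + b) · f ≈ᴾ a · f +ᴾ b · f
  ·-distribʳ a b f n = distribʳ _ _ _

  ·-assoc : ∀ a b f → a · b · f ≈ᴾ (a * b) · f
  ·-assoc a b f n = sym (*-assoc _ _ _)

  ·-*ᴾˡ : ∀ a f g → (a · f) *ᴾ g ≈ᴾ a · (f *ᴾ g)
  ·-*ᴾˡ a f g n = trans (Σ-cong′ (suc n) (λ i → *-assoc _ _ _)) (sym (*-distribˡ-Σ (suc n) a _))

  ·-*ᴾʳ : ∀ a f g → f *ᴾ (a · g) ≈ᴾ a · (f *ᴾ g)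
  ·-*ᴾʳ a f g n = trans (*ᴾ-comm f (a · g) n) (trans (·-*ᴾˡ a g f n) (*-congˡ (*ᴾ-comm g f n)))

  Σᴾ-apply : ∀ N (G : ℕ → PS R) i → sumR PS-commutativeRing N G i ≈ Σ N (λ n → G n i)
  Σᴾ-apply zero    G i = refl
  Σᴾ-apply (suc N) G i = +-congʳ (Σᴾ-apply N G i)

  Σᴾ-· : ∀ N (f : ℕ → Carrier) g → sumR PS-commutativeRing N (λ n → f n · g) ≈ᴾ Σ N f · g
  Σᴾ-· N f g i = trans (Σᴾ-apply N (λ n → f n · g) i) (sym (*-distribʳ-Σ N (g i) f))

  ^ₚ≈^ᴾ : ∀ f n → _^ₚ_ R f n ≈ᴾ f ^ᴾ n
  ^ₚ≈^ᴾ f zero    = 𝑃.refl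
  ^ₚ≈^ᴾ f (suc n) = *ᴾ-cong {f} 𝑃.refl (^ₚ≈^ᴾ f n)

  monomial-^ᴾ : ∀ a j n → (a · T^ j) ^ᴾ n ≈ᴾ (a ^ n) · T^ (j ℕ.* n)
  monomial-^ᴾ a j zero    zero    rewrite ℕₚ.*-zeroʳ j = sym (*-identityˡ _)
  monomial-^ᴾ a j zero    (suc i) rewrite ℕₚ.*-zeroʳ j = sym (*-identityˡ _)
  monomial-^ᴾ a j (suc n) = begin
    (a · T^ j) *ᴾ (a · T^ j) ^ᴾ n             ≈⟨ *ᴾ-cong {a · T^ j} 𝑃.refl (monomial-^ᴾ a j n) ⟩
    (a · T^ j) *ᴾ ((a ^ n) · T^ (j ℕ.* n))    ≈⟨ ·-*ᴾˡ a (T^ j) ((a ^ n) · T^ (j ℕ.* n)) ⟩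
    a · (T^ j *ᴾ ((a ^ n) · T^ (j ℕ.* n)))    ≈⟨ ·-cong refl (·-*ᴾʳ (a ^ n) (T^ j) (T^ (j ℕ.* n))) ⟩
    a · (a ^ n) · (T^ j *ᴾ T^ (j ℕ.* n))      ≈⟨ ·-assoc a (a ^ n) (T^ j *ᴾ T^ (j ℕ.* n)) ⟩
    (a ^ suc n) · (T^ j *ᴾ T^ (j ℕ.* n))      ≈⟨ ·-cong refl (T^-*ᴾ j (j ℕ.* n)) ⟩
    (a ^ suc n) · T^ (j ℕ.+ j ℕ.* n)          ≡⟨ ≡.cong (λ k → (a ^ suc n) · T^ k) (ℕₚ.*-suc j n) ⟨
    (a ^ suc n) · T^ (j ℕ.* suc n)            ∎
    where open import Relation.Binary.Reasoning.Setoid 𝑃.setoid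

  ι-PS : ∀ n → ι PS-commutativeRing n ≈ᴾ ι R n · oneₚ R
  ι-PS zero    i = sym (zeroˡ _)
  ι-PS (suc n) i = trans (+-cong (sym (*-identityˡ _)) (ι-PS n i)) (sym (distribʳ _ _ _))

  AgreeUpTo : ℕ → PS R → PS R → Set ℓ
  AgreeUpTo i f g = ∀ j → j ≤ i → f j ≈ g j

  *ᴾ-agree : ∀ i {f f′ g g′} → AgreeUpTo i f f′ → AgreeUpTo i g g′ → AgreeUpTo i (f *ᴾ g) (f′ *ᴾ g′)
  *ᴾ-agree i f≈f′ g≈g′ j j≤i = Σ-cong (suc j) (λ a a<1+j →
    *-cong (f≈f′ a (ℕₚ.≤-trans (ℕₚ.≤-pred a<1+j) j≤i)) (g≈g′ (j ∸ a) (ℕₚ.≤-trans (ℕₚ.m∸n≤m j a) j≤i)))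

  ^ₚ-agree : ∀ i {f g} n → AgreeUpTo i f g → AgreeUpTo i (_^ₚ_ R f n) (_^ₚ_ R g n)
  ^ₚ-agree i zero    f≈g j _ = refl
  ^ₚ-agree i (suc n) f≈g = *ᴾ-agree i f≈g (^ₚ-agree i n f≈g)

  VanishesBelow : ℕ → PS R → Set ℓ
  VanishesBelow l f = ∀ j → j < l → f j ≈ 0#

  *ᴾ-vanishesˡ : ∀ {l} f g → VanishesBelow l f → VanishesBelow l (f *ᴾ g)
  *ᴾ-vanishesˡ f g f≈0 j j<l = Σ-zero (suc j) (λ a a<1+j →
    trans (*-congʳ (f≈0 a (ℕₚ.≤-<-trans (ℕₚ.≤-pred a<1+j) j<l))) (zeroˡ _))

  *ᴾ-vanishesʳ : ∀ {l} f g → VanishesBelow l g → VanishesBelow l (f *ᴾ g)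
  *ᴾ-vanishesʳ f g g≈0 j j<l = Σ-zero (suc j) (λ a _ →
    trans (*-congˡ (g≈0 (j ∸ a) (ℕₚ.≤-<-trans (ℕₚ.m∸n≤m j a) j<l))) (zeroʳ _))

  ·-vanishes : ∀ {l} a f → VanishesBelow l f → VanishesBelow l (a · f)
  ·-vanishes a f f≈0 j j<l = trans (*-congˡ (f≈0 j j<l)) (zeroʳ _)

  ^ₚ-vanishes : ∀ f → f 0 ≈ 0# → ∀ l → VanishesBelow l (_^ₚ_ R f l)
  ^ₚ-vanishes f f₀≈0 (suc l) j j<1+l = Σ-zero (suc j) term≈0
    where
      term≈0 : ∀ a → a < suc j → f a * _^ₚ_ R f l (j ∸ a) ≈ 0#
      term≈0 zero    _       = trans (*-congʳ f₀≈0) (zeroˡ _)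
      term≈0 (suc a) a<1+j = trans (*-congˡ (^ₚ-vanishes f f₀≈0 l (j ∸ suc a) j∸1+a<l)) (zeroʳ _)
        where
          j∸1+a<l : j ∸ suc a < l
          j∸1+a<l = ℕₚ.<-≤-trans (ℕₚ.∸-monoʳ-< {j} {suc a} {a} (ℕₚ.n<1+n a) (ℕₚ.≤-pred a<1+j))
                                 (ℕₚ.≤-trans (ℕₚ.m∸n≤m j a) (ℕₚ.≤-pred j<1+l))

  truncate : ℕ → PS R → PS R
  truncate K f = sumR PS-commutativeRing K (λ a → f a · T^ a)

  truncate-coef : ∀ K f j → j < K → truncate K f j ≈ f j
  truncate-coef K f j j<K = trans (Σᴾ-apply K (λ a → f a · T^ a) j)
    (trans (Σ-single K j _ j<K (λ a _ a≢j → trans (*-congˡ (T^-≢ (λ j≡a → a≢j (≡.sym j≡a)))) (zeroʳ _)))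
           (trans (*-congˡ (T^-≡ {j} ≡.refl)) (*-identityʳ _)))

  D-truncate-agree : ∀ i n K f → i ℕ.+ n < K → AgreeUpTo i (D R n f) (D R n (truncate K f))
  D-truncate-agree i n K f i+n<K j j≤i =
    *-congˡ (sym (truncate-coef K f (j ℕ.+ n) (ℕₚ.≤-<-trans (ℕₚ.+-monoˡ-≤ n j≤i) i+n<K)))

  D-truncate : ∀ K n f → D R n (truncate K f) ≈ᴾ sumR PS-commutativeRing K (λ k → f k · ι R (k C n) · T^ (k ∸ n))
  D-truncate K n f j = begin
    ι R ((j ℕ.+ n) C n) * truncate K f (j ℕ.+ n)               ≈⟨ *-congˡ (Σᴾ-apply K (λ a → f a · T^ a) (j ℕ.+ n)) ⟩
    ι R ((j ℕ.+ n) C n) * Σ K (λ k → f k * (T^ k) (j ℕ.+ n))   ≈⟨ *-distribˡ-Σ K _ _ ⟩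
    Σ K (λ k → ι R ((j ℕ.+ n) C n) * (f k * (T^ k) (j ℕ.+ n))) ≈⟨ Σ-cong′ K term ⟩
    Σ K (λ k → f k * (ι R (k C n) * (T^ (k ∸ n)) j))           ≈⟨ Σᴾ-apply K (λ k → f k · ι R (k C n) · T^ (k ∸ n)) j ⟨
    sumR PS-commutativeRing K (λ k → f k · ι R (k C n) · T^ (k ∸ n)) j ∎
    where
      open import Relation.Binary.Reasoning.Setoid setoid
      term : ∀ k → ι R ((j ℕ.+ n) C n) * (f k * (T^ k) (j ℕ.+ n)) ≈ f k * (ι R (k C n) * (T^ (k ∸ n)) j)
      term k with k ℕₚ.≟ j ℕ.+ n
      ... | yes ≡.refl = begin
        ι R ((j ℕ.+ n) C n) * (f (j ℕ.+ n) * (T^ (j ℕ.+ n)) (j ℕ.+ n))  ≈⟨ *-congˡ (trans (*-congˡ (T^-≡ {j ℕ.+ n} ≡.refl)) (*-identityʳ _)) ⟩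
        ι R ((j ℕ.+ n) C n) * f (j ℕ.+ n)                                ≈⟨ *-comm _ _ ⟩
        f (j ℕ.+ n) * ι R ((j ℕ.+ n) C n)                                ≈⟨ *-congˡ (*-identityʳ _) ⟨
        f (j ℕ.+ n) * (ι R ((j ℕ.+ n) C n) * 1#)                         ≈⟨ *-congˡ (*-congˡ (T^-≡ (≡.sym (ℕₚ.m+n∸n≡m j n)))) ⟨
        f (j ℕ.+ n) * (ι R ((j ℕ.+ n) C n) * (T^ (j ℕ.+ n ∸ n)) j)       ∎
      ... | no k≢j+n = trans (trans (*-congˡ (trans (*-congˡ (T^-≢ (λ j+n≡k → k≢j+n (≡.sym j+n≡k)))) (zeroʳ _))) (zeroʳ _))
                             (sym rhs≈0)
        where
          rhs≈0 : f k * (ι R (k C n) * (T^ (k ∸ n)) j) ≈ 0#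
          rhs≈0 with n ℕₚ.≤? k
          ... | yes n≤k = trans (*-congˡ (trans (*-congˡ (T^-≢ (λ j≡k∸n → k≢j+n
                  (≡.trans (≡.sym (ℕₚ.m∸n+n≡m n≤k)) (≡.cong (ℕ._+ n) (≡.sym j≡k∸n)))))) (zeroʳ _))) (zeroʳ _)
          ... | no  n≰k = trans (*-congˡ (trans (*-congʳ (reflexive (≡.cong (ι R) (k>n⇒nCk≡0 (ℕₚ.≰⇒> n≰k))))) (zeroˡ _))) (zeroʳ _)

module CartierHasse {c ℓ : Level} (R : CommutativeRing c ℓ) (q : ℕ) (𝔽 : IsFiniteField R q)
                    (t m r : ℕ) (r<Q : r < q ℕ.^ m) where
  open CommutativeRing R hiding (zero)
  open Sums R
  open NaturalEmbedding R
  open BinomialSums R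
  open PowerSeries R
  open IsFiniteField 𝔽 using (p; p-prime) renaming (k to d; q≡p^k to q≡p^d)
  open FiniteField R q 𝔽 using (ι-p≈0; fermat-^)
  open Frobenius R p-prime ι-p≈0 using (ι-C-prime-power≈0; sgn-pᵉ)
  open import Data.Nat.Combinatorics using (_C_; k>n⇒nCk≡0; nCn≡1; nCk+nC[k+1]≡[n+1]C[k+1])
  private
    module 𝑃 = CommutativeRing PS-commutativeRing
    module Σᴾ = Sums PS-commutativeRing

  Q P : ℕ
  Q = q ℕ.^ m
  P = q ℕ.^ t

  q^≡p^ : ∀ n → q ℕ.^ n ≡ p ℕ.^ (d ℕ.* n)
  q^≡p^ n = ≡.trans (≡.cong (ℕ._^ n) q≡p^d) (ℕₚ.^-*-assoc p d n)

  q^≢0 : ∀ n → NonZero (q ℕ.^ n)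
  q^≢0 n = ≡.subst NonZero (≡.sym (q^≡p^ n)) (ℕₚ.m^n≢0 p (d ℕ.* n) {{prime⇒nonZero p-prime}})

  instance
    Q≢0 : NonZero Q
    Q≢0 = q^≢0 m
    P≢0 : NonZero P
    P≢0 = q^≢0 t

  data Decomposition : ℕ → Set where
    _*Q+_⟨_⟩ : ∀ l s → s < Q → Decomposition (l ℕ.* Q ℕ.+ s)

  decompose : ∀ n → Decomposition n
  decompose n = ≡.subst Decomposition (≡.sym n≡[n/Q]*Q+n%Q) ((n / Q) *Q+ (n % Q) ⟨ m%n<n n Q ⟩)
    where
      open import Data.Nat.DivMod using (_/_; _%_; m≡m%n+[m/n]*n; m%n<n)
      n≡[n/Q]*Q+n%Q : n ≡ n / Q ℕ.* Q ℕ.+ n % Q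
      n≡[n/Q]*Q+n%Q = ≡.trans (m≡m%n+[m/n]*n n Q) (ℕₚ.+-comm (n % Q) _)

  V : PS R
  V = _-ₚ_ R (T^ Q) (T^ P)

  V₀≈0 : V 0 ≈ 0#
  V₀≈0 = trans (+-cong (T^-≢ (0≢ Q)) (-‿cong (T^-≢ (0≢ P)))) (trans (+-identityˡ _) -0#≈0#)
    where
      open import Algebra.Properties.Ring ring using (-0#≈0#)
      0≢ : ∀ n → {{NonZero n}} → 0 ≢ n
      0≢ n 0≡n = ℕ.≢-nonZero⁻¹ n (≡.sym 0≡n)

  coef : ℕ → PS R
  coef = Coef R q t r m

  coefOf : ℕ → ℕ → ℕ → PS R
  coefOf n l s = if s ℕ.<ᵇ r then zeroₚ R else (sgn R (n ∸ r) * ι R (s C r)) · (T^ (s ∸ r) *ᴾ _^ₚ_ R V l)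

  coef-*Q+ : ∀ l s → s < Q → coef (l ℕ.* Q ℕ.+ s) ≡ coefOf (l ℕ.* Q ℕ.+ s) l s
  coef-*Q+ l s s<Q with split Q (l ℕ.* Q ℕ.+ s) | split-*+ Q l s s<Q
  ... | .(l , s) | ≡.refl = ≡.refl

  coefOf-step : ∀ l s → coefOf (suc l ℕ.* Q ℕ.+ s) (suc l) s ≈ᴾ sgn R Q · (V *ᴾ coefOf (l ℕ.* Q ℕ.+ s) l s)
  coefOf-step l s with s ℕ.<ᵇ r in s<ᵇr
  ... | true  = λ i → sym (trans (*-congˡ (Σ-zero (suc i) (λ _ _ → zeroʳ _))) (zeroʳ _))
  ... | false = begin
    (sgn R (suc l ℕ.* Q ℕ.+ s ∸ r) * ι R (s C r)) · (T^ (s ∸ r) *ᴾ (V *ᴾ W)) ≈⟨ ·-cong scalar (x∙yz≈y∙xz (T^ (s ∸ r)) V W) ⟩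
    (sgn R Q * b) · (V *ᴾ (T^ (s ∸ r) *ᴾ W))                                ≈⟨ ·-assoc (sgn R Q) b _ ⟨
    sgn R Q · b · (V *ᴾ (T^ (s ∸ r) *ᴾ W))                                  ≈⟨ ·-cong refl (·-*ᴾʳ b V (T^ (s ∸ r) *ᴾ W)) ⟨
    sgn R Q · (V *ᴾ b · (T^ (s ∸ r) *ᴾ W))                                  ∎
    where
      open import Relation.Binary.Reasoning.Setoid 𝑃.setoid
      open import Algebra.Properties.CommutativeSemigroup 𝑃.*-commutativeSemigroup using (x∙yz≈y∙xz)
      W : PS R
      W = _^ₚ_ R V l
      b : Carrier
      b = sgn R (l ℕ.* Q ℕ.+ s ∸ r) * ι R (s C r)
      r≤s : r ≤ s
      r≤s = ℕₚ.≮⇒≥ (λ s<r → ≡.subst T s<ᵇr (ℕₚ.<⇒<ᵇ s<r))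
      exponent : suc l ℕ.* Q ℕ.+ s ∸ r ≡ Q ℕ.+ (l ℕ.* Q ℕ.+ s ∸ r)
      exponent = ≡.trans (≡.cong (_∸ r) (ℕₚ.+-assoc Q (l ℕ.* Q) s))
                         (ℕₚ.+-∸-assoc Q (ℕₚ.≤-trans r≤s (ℕₚ.m≤n+m s (l ℕ.* Q))))
      scalar : sgn R (suc l ℕ.* Q ℕ.+ s ∸ r) * ι R (s C r) ≈ sgn R Q * b
      scalar = trans (*-congʳ (trans (reflexive (≡.cong (sgn R) exponent)) (sgn-+ Q _))) (*-assoc _ _ _)

  coef-+Q : ∀ v → coef (Q ℕ.+ v) ≈ᴾ sgn R Q · (V *ᴾ coef v)
  coef-+Q v with decompose v
  ... | l *Q+ s ⟨ s<Q ⟩ rewrite ≡.sym (ℕₚ.+-assoc Q (l ℕ.* Q) s)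
                              | coef-*Q+ (suc l) s s<Q | coef-*Q+ l s s<Q = coefOf-step l s

  coef-vanishes : ∀ i n → suc i ℕ.* Q ≤ n → VanishesBelow (suc i) (coef n)
  coef-vanishes i n [1+i]Q≤n with decompose n
  ... | l *Q+ s ⟨ s<Q ⟩ rewrite coef-*Q+ l s s<Q = coefOf-vanishes
    where
      1+i≤l : suc i ≤ l
      1+i≤l = ℕₚ.≮⇒≥ (λ l<1+i → ℕₚ.<-irrefl ≡.refl (begin-strict
        l ℕ.* Q ℕ.+ s  <⟨ ℕₚ.+-monoʳ-< (l ℕ.* Q) s<Q ⟩
        l ℕ.* Q ℕ.+ Q  ≡⟨ ℕₚ.+-comm (l ℕ.* Q) Q ⟩
        suc l ℕ.* Q    ≤⟨ ℕₚ.*-monoˡ-≤ Q l<1+i ⟩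
        suc i ℕ.* Q    ≤⟨ [1+i]Q≤n ⟩
        l ℕ.* Q ℕ.+ s  ∎))
        where open ℕₚ.≤-Reasoning
      coefOf-vanishes : VanishesBelow (suc i) (coefOf (l ℕ.* Q ℕ.+ s) l s)
      coefOf-vanishes with s ℕ.<ᵇ r
      ... | true  = λ _ _ → refl
      ... | false = ·-vanishes _ _ (*ᴾ-vanishesʳ (T^ (s ∸ r)) _ (λ j j<1+i →
                      ^ₚ-vanishes V V₀≈0 l j (ℕₚ.<-≤-trans j<1+i 1+i≤l)))

  ι-C-Q≈0 : ∀ n → 0 < n → n < Q → ι R (Q C n) ≈ 0#
  ι-C-Q≈0 n 0<n n<Q = ≡.subst (λ M → ι R (M C n) ≈ 0#) (≡.sym (q^≡p^ m))
    (ι-C-prime-power≈0 (d ℕ.* m) n 0<n (≡.subst (n <_) (q^≡p^ m) n<Q))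

  shiftedC : ℕ → ℕ → Carrier
  shiftedC k n with Q ℕₚ.≤? n
  ... | yes _ = ι R (k C (n ∸ Q))
  ... | no  _ = 0#

  ι-pascal : ∀ k n → ι R (k C n) + ι R (k C suc n) ≈ ι R (suc k C suc n)
  ι-pascal k n = trans (sym (ι-+ (k C n) (k C suc n))) (reflexive (≡.cong (ι R) (nCk+nC[k+1]≡[n+1]C[k+1] k n)))

  shiftedC-pascal : ∀ k n → shiftedC k n + shiftedC k (suc n) ≈ shiftedC (suc k) (suc n)
  shiftedC-pascal k n with Q ℕₚ.≤? n | Q ℕₚ.≤? suc n
  ... | yes Q≤n | no  Q≰1+n = ⊥-elim (Q≰1+n (ℕₚ.m≤n⇒m≤1+n Q≤n))
  ... | yes Q≤n | yes _ rewrite ℕₚ.+-∸-assoc 1 Q≤n = ι-pascal k (n ∸ Q)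
  ... | no  Q≰n | yes Q≤1+n rewrite ℕₚ.≤-antisym Q≤1+n (ℕₚ.≰⇒> Q≰n) | ℕₚ.n∸n≡0 (suc n) = +-identityˡ _
  ... | no  _   | no  _     = +-identityˡ _

  ι-C-Q : ∀ n → ι R (Q C n) ≈ ι R (0 C n) + shiftedC 0 n
  ι-C-Q n with Q ℕₚ.≤? n
  ι-C-Q zero    | yes Q≤0 = ⊥-elim (ℕ.≢-nonZero⁻¹ Q (ℕₚ.n≤0⇒n≡0 Q≤0))
  ι-C-Q zero    | no  _   = sym (+-identityʳ _)
  ι-C-Q (suc n) | no  Q≰n = trans (ι-C-Q≈0 (suc n) (s≤s z≤n) (ℕₚ.≰⇒> Q≰n)) (sym (+-identityˡ 0#))
  ι-C-Q (suc n) | yes Q≤n with ℕₚ.m≤n⇒m<n∨m≡n Q≤n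
  ... | inj₁ Q<n = trans (reflexive (≡.cong (ι R) (k>n⇒nCk≡0 Q<n)))
                         (sym (trans (+-identityˡ _) (reflexive (≡.cong (λ j → ι R (0 C j)) (ℕₚ.+-∸-assoc 1 (ℕₚ.≤-pred Q<n))))))
  ... | inj₂ Q≡1+n = trans (reflexive (≡.cong (ι R) (≡.trans (≡.cong (_C suc n) Q≡1+n) (nCn≡1 (suc n)))))
                       (sym (trans (+-identityˡ _) (reflexive (≡.cong (λ j → ι R (0 C j)) 1+n∸Q≡0))))
    where
      1+n∸Q≡0 : suc n ∸ Q ≡ 0
      1+n∸Q≡0 = ≡.trans (≡.cong (suc n ∸_) Q≡1+n) (ℕₚ.n∸n≡0 (suc n))

  -- Lucas: (1 + X)^(k+Q) = (1 + X)^k (1 + X^Q) in characteristic p.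
  ι-C-+Q : ∀ k n → ι R ((k ℕ.+ Q) C n) ≈ ι R (k C n) + shiftedC k n
  ι-C-+Q zero    n       = ι-C-Q n
  ι-C-+Q (suc k) zero    = sym (trans (+-congˡ shiftedC-0) (+-identityʳ _))
    where
      shiftedC-0 : shiftedC (suc k) 0 ≈ 0#
      shiftedC-0 with Q ℕₚ.≤? 0
      ... | yes Q≤0 = ⊥-elim (ℕ.≢-nonZero⁻¹ Q (ℕₚ.n≤0⇒n≡0 Q≤0))
      ... | no  _   = refl
  ι-C-+Q (suc k) (suc n) = begin
    ι R (suc (k ℕ.+ Q) C suc n)                                        ≈⟨ ι-pascal (k ℕ.+ Q) n ⟨
    ι R ((k ℕ.+ Q) C n) + ι R ((k ℕ.+ Q) C suc n)                      ≈⟨ +-cong (ι-C-+Q k n) (ι-C-+Q k (suc n)) ⟩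
    (ι R (k C n) + shiftedC k n) + (ι R (k C suc n) + shiftedC k (suc n)) ≈⟨ +-interchange _ _ _ _ ⟩
    (ι R (k C n) + ι R (k C suc n)) + (shiftedC k n + shiftedC k (suc n)) ≈⟨ +-cong (ι-pascal k n) (shiftedC-pascal k n) ⟩
    ι R (suc k C suc n) + shiftedC (suc k) (suc n)                      ∎
    where
      open import Relation.Binary.Reasoning.Setoid setoid
      open import Algebra.Properties.CommutativeSemigroup +-commutativeSemigroup using () renaming (interchange to +-interchange)

  shiftedC-< : ∀ k n → n < Q → shiftedC k n ≈ 0#
  shiftedC-< k n n<Q with Q ℕₚ.≤? n
  ... | yes Q≤n = ⊥-elim (ℕₚ.<⇒≱ n<Q Q≤n)
  ... | no  _   = refl

  shiftedC-+Q : ∀ k v → shiftedC k (Q ℕ.+ v) ≈ ι R (k C v)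
  shiftedC-+Q k v with Q ℕₚ.≤? Q ℕ.+ v
  ... | yes _   = reflexive (≡.cong (λ j → ι R (k C j)) (ℕₚ.m+n∸m≡n Q v))
  ... | no  Q≰ = ⊥-elim (Q≰ (ℕₚ.m≤m+n Q v))

  -- kernel k is the coefficient of x_k in Σ_n Coef n · D_n(x).
  kernelTerm : ℕ → ℕ → PS R
  kernelTerm k n = coef n *ᴾ ι R (k C n) · T^ (k ∸ n)

  kernel : ℕ → PS R
  kernel k = sumR PS-commutativeRing (suc k) (kernelTerm k)

  Σ-unshifted : ∀ k → Σᴾ.Σ (suc (k ℕ.+ Q)) (λ n → coef n *ᴾ ι R (k C n) · T^ (k ℕ.+ Q ∸ n)) ≈ᴾ T^ Q *ᴾ kernel k
  Σ-unshifted k = begin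
    Σᴾ.Σ (suc k ℕ.+ Q) (λ n → coef n *ᴾ ι R (k C n) · T^ (k ℕ.+ Q ∸ n))
      ≈⟨ Σᴾ.Σ-extend (suc k) Q _ (λ n 1+k≤n → 𝑃.trans (*ᴾ-cong {coef n} 𝑃.refl (·-zero (T^ (k ℕ.+ Q ∸ n)) (reflexive (≡.cong (ι R) (k>n⇒nCk≡0 1+k≤n)))))
                                                        (𝑃.zeroʳ (coef n))) ⟩
    Σᴾ.Σ (suc k) (λ n → coef n *ᴾ ι R (k C n) · T^ (k ℕ.+ Q ∸ n))
      ≈⟨ Σᴾ.Σ-cong (suc k) (λ n n<1+k → factor n (ℕₚ.≤-pred n<1+k)) ⟩
    Σᴾ.Σ (suc k) (λ n → T^ Q *ᴾ kernelTerm k n)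
      ≈⟨ Σᴾ.*-distribˡ-Σ (suc k) (T^ Q) (kernelTerm k) ⟨
    T^ Q *ᴾ kernel k ∎
    where
      open import Relation.Binary.Reasoning.Setoid 𝑃.setoid
      open import Algebra.Properties.CommutativeSemigroup 𝑃.*-commutativeSemigroup using (x∙yz≈y∙xz)
      factor : ∀ n → n ≤ k → coef n *ᴾ ι R (k C n) · T^ (k ℕ.+ Q ∸ n) ≈ᴾ T^ Q *ᴾ kernelTerm k n
      factor n n≤k = begin
        coef n *ᴾ ι R (k C n) · T^ (k ℕ.+ Q ∸ n)     ≡⟨ ≡.cong (λ j → coef n *ᴾ ι R (k C n) · T^ j)
                                                              (≡.trans (ℕₚ.+-∸-comm Q n≤k) (ℕₚ.+-comm (k ∸ n) Q)) ⟩
        coef n *ᴾ ι R (k C n) · T^ (Q ℕ.+ (k ∸ n))   ≈⟨ *ᴾ-cong {coef n} 𝑃.refl (·-cong refl (T^-*ᴾ Q (k ∸ n))) ⟨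
        coef n *ᴾ ι R (k C n) · (T^ Q *ᴾ T^ (k ∸ n)) ≈⟨ *ᴾ-cong {coef n} 𝑃.refl (·-*ᴾʳ (ι R (k C n)) (T^ Q) (T^ (k ∸ n))) ⟨
        coef n *ᴾ (T^ Q *ᴾ ι R (k C n) · T^ (k ∸ n)) ≈⟨ x∙yz≈y∙xz (coef n) (T^ Q) (ι R (k C n) · T^ (k ∸ n)) ⟩
        T^ Q *ᴾ kernelTerm k n                        ∎

  Σ-shifted : ∀ k → Σᴾ.Σ (suc (k ℕ.+ Q)) (λ n → coef n *ᴾ shiftedC k n · T^ (k ℕ.+ Q ∸ n)) ≈ᴾ sgn R Q · (V *ᴾ kernel k)
  Σ-shifted k = begin
    Σᴾ.Σ (suc (k ℕ.+ Q)) term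
      ≡⟨ ≡.cong (λ j → Σᴾ.Σ j term) (ℕₚ.+-comm (suc k) Q) ⟩
    Σᴾ.Σ (Q ℕ.+ suc k) term
      ≈⟨ Σᴾ.Σ-+ Q (suc k) term ⟩
    Σᴾ.Σ Q term +ᴾ Σᴾ.Σ (suc k) (λ v → term (Q ℕ.+ v))
      ≈⟨ 𝑃.+-cong (Σᴾ.Σ-zero Q (λ n n<Q → 𝑃.trans (*ᴾ-cong {coef n} 𝑃.refl (·-zero (T^ (k ℕ.+ Q ∸ n)) (shiftedC-< k n n<Q))) (𝑃.zeroʳ (coef n))))
                  (Σᴾ.Σ-cong′ (suc k) term-+Q) ⟩
    zeroₚ R +ᴾ Σᴾ.Σ (suc k) (λ v → (sgn R Q · V) *ᴾ kernelTerm k v)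
      ≈⟨ 𝑃.+-identityˡ _ ⟩
    Σᴾ.Σ (suc k) (λ v → (sgn R Q · V) *ᴾ kernelTerm k v)
      ≈⟨ Σᴾ.*-distribˡ-Σ (suc k) (sgn R Q · V) (kernelTerm k) ⟨
    (sgn R Q · V) *ᴾ kernel k
      ≈⟨ ·-*ᴾˡ (sgn R Q) V (kernel k) ⟩
    sgn R Q · (V *ᴾ kernel k) ∎
    where
      open import Relation.Binary.Reasoning.Setoid 𝑃.setoid
      term : ℕ → PS R
      term n = coef n *ᴾ shiftedC k n · T^ (k ℕ.+ Q ∸ n)
      term-+Q : ∀ v → term (Q ℕ.+ v) ≈ᴾ (sgn R Q · V) *ᴾ kernelTerm k v
      term-+Q v = begin
        coef (Q ℕ.+ v) *ᴾ shiftedC k (Q ℕ.+ v) · T^ (k ℕ.+ Q ∸ (Q ℕ.+ v))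
          ≡⟨ ≡.cong (λ j → coef (Q ℕ.+ v) *ᴾ shiftedC k (Q ℕ.+ v) · T^ j)
                    (≡.trans (≡.cong (_∸ (Q ℕ.+ v)) (ℕₚ.+-comm k Q)) (ℕₚ.[m+n]∸[m+o]≡n∸o Q k v)) ⟩
        coef (Q ℕ.+ v) *ᴾ shiftedC k (Q ℕ.+ v) · T^ (k ∸ v)
          ≈⟨ *ᴾ-cong (coef-+Q v) (·-cong {f = T^ (k ∸ v)} (shiftedC-+Q k v) 𝑃.refl) ⟩
        (sgn R Q · (V *ᴾ coef v)) *ᴾ ι R (k C v) · T^ (k ∸ v)
          ≈⟨ ·-*ᴾˡ (sgn R Q) (V *ᴾ coef v) (ι R (k C v) · T^ (k ∸ v)) ⟩
        sgn R Q · ((V *ᴾ coef v) *ᴾ ι R (k C v) · T^ (k ∸ v))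
          ≈⟨ ·-cong refl (*ᴾ-assoc V (coef v) (ι R (k C v) · T^ (k ∸ v))) ⟩
        sgn R Q · (V *ᴾ kernelTerm k v)
          ≈⟨ ·-*ᴾˡ (sgn R Q) V (kernelTerm k v) ⟨
        (sgn R Q · V) *ᴾ kernelTerm k v ∎

  kernel-+Q-split : ∀ k → kernel (k ℕ.+ Q) ≈ᴾ T^ Q *ᴾ kernel k +ᴾ sgn R Q · (V *ᴾ kernel k)
  kernel-+Q-split k = begin
    Σᴾ.Σ (suc (k ℕ.+ Q)) (kernelTerm (k ℕ.+ Q))
      ≈⟨ Σᴾ.Σ-cong′ (suc (k ℕ.+ Q)) split-term ⟩
    Σᴾ.Σ (suc (k ℕ.+ Q)) (λ n → unshifted n +ᴾ shifted n)
      ≈⟨ Σᴾ.Σ-distrib-+ (suc (k ℕ.+ Q)) unshifted shifted ⟩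
    Σᴾ.Σ (suc (k ℕ.+ Q)) unshifted +ᴾ Σᴾ.Σ (suc (k ℕ.+ Q)) shifted
      ≈⟨ 𝑃.+-cong (Σ-unshifted k) (Σ-shifted k) ⟩
    T^ Q *ᴾ kernel k +ᴾ sgn R Q · (V *ᴾ kernel k) ∎
    where
      open import Relation.Binary.Reasoning.Setoid 𝑃.setoid
      unshifted shifted : ℕ → PS R
      unshifted n = coef n *ᴾ ι R (k C n) · T^ (k ℕ.+ Q ∸ n)
      shifted   n = coef n *ᴾ shiftedC k n · T^ (k ℕ.+ Q ∸ n)
      split-term : ∀ n → kernelTerm (k ℕ.+ Q) n ≈ᴾ unshifted n +ᴾ shifted n
      split-term n = 𝑃.trans (*ᴾ-cong {coef n} 𝑃.refl (𝑃.trans (·-cong (ι-C-+Q k n) 𝑃.refl) (·-distribʳ _ _ monomial)))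
                             (*ᴾ-distribˡ-+ᴾ (coef n) (ι R (k C n) · monomial) (shiftedC k n · monomial))
        where
          monomial : PS R
          monomial = T^ (k ℕ.+ Q ∸ n)

  kernel-+Q : ∀ k → kernel (k ℕ.+ Q) ≈ᴾ T^ P *ᴾ kernel k
  kernel-+Q k = begin
    kernel (k ℕ.+ Q)                                       ≈⟨ kernel-+Q-split k ⟩
    T^ Q *ᴾ kernel k +ᴾ sgn R Q · (V *ᴾ kernel k)           ≈⟨ 𝑃.+-congˡ (λ i → trans (*-congʳ sgn-Q≈-1) (-1*x≈-x _)) ⟩
    T^ Q *ᴾ kernel k 𝑃.- V *ᴾ kernel k                      ≈⟨ 𝑃.+-congˡ (𝑃.-‿cong (𝑃.trans (𝑃.distribʳ (kernel k) (T^ Q) _)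
                                                                (𝑃.+-congˡ (𝑃.sym (-‿distribˡ-* (T^ P) (kernel k)))))) ⟩
    T^ Q *ᴾ kernel k 𝑃.- (T^ Q *ᴾ kernel k 𝑃.- T^ P *ᴾ kernel k) ≈⟨ x-[x-y]≈y (T^ Q *ᴾ kernel k) (T^ P *ᴾ kernel k) ⟩
    T^ P *ᴾ kernel k                                        ∎
    where
      open import Relation.Binary.Reasoning.Setoid 𝑃.setoid
      open import Algebra.Properties.Ring ring using (-1*x≈-x)
      open import Algebra.Properties.Ring 𝑃.ring using (⁻¹-anti-homo‿-; xyx⁻¹≈y; -‿distribˡ-*)
      sgn-Q≈-1 : sgn R Q ≈ - 1#
      sgn-Q≈-1 = trans (reflexive (≡.cong (sgn R) (q^≡p^ m))) (sgn-pᵉ (d ℕ.* m))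
      x-[x-y]≈y : ∀ x y → x 𝑃.- (x 𝑃.- y) ≈ᴾ y
      x-[x-y]≈y x y = 𝑃.trans (𝑃.+-congˡ (⁻¹-anti-homo‿- x y)) (𝑃.trans (𝑃.sym (𝑃.+-assoc x y (𝑃.- x))) (xyx⁻¹≈y x y))

  kernelTerm-base : ∀ b n → n ≤ b → b < Q → kernelTerm b n ≈ᴾ inversionTerm b r n · T^ (b ∸ r)
  kernelTerm-base b n n≤b b<Q rewrite coef-*Q+ 0 n (ℕₚ.≤-<-trans n≤b b<Q) with n ℕ.<ᵇ r in n<ᵇr
  ... | true  = 𝑃.trans (𝑃.zeroˡ (ι R (b C n) · T^ (b ∸ n))) (𝑃.sym (·-zero (T^ (b ∸ r)) refl))
  ... | false = begin
    (w · (T^ (n ∸ r) *ᴾ oneₚ R)) *ᴾ ι R (b C n) · T^ (b ∸ n) ≈⟨ *ᴾ-cong {g = ι R (b C n) · T^ (b ∸ n)} (·-cong refl (𝑃.*-identityʳ (T^ (n ∸ r)))) 𝑃.refl ⟩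
    (w · T^ (n ∸ r)) *ᴾ ι R (b C n) · T^ (b ∸ n)             ≈⟨ ·-*ᴾˡ w (T^ (n ∸ r)) (ι R (b C n) · T^ (b ∸ n)) ⟩
    w · (T^ (n ∸ r) *ᴾ ι R (b C n) · T^ (b ∸ n))             ≈⟨ ·-cong refl (·-*ᴾʳ (ι R (b C n)) (T^ (n ∸ r)) (T^ (b ∸ n))) ⟩
    w · ι R (b C n) · (T^ (n ∸ r) *ᴾ T^ (b ∸ n))             ≈⟨ ·-assoc w (ι R (b C n)) _ ⟩
    (w * ι R (b C n)) · (T^ (n ∸ r) *ᴾ T^ (b ∸ n))           ≈⟨ ·-cong refl (T^-*ᴾ (n ∸ r) (b ∸ n)) ⟩
    (w * ι R (b C n)) · T^ (n ∸ r ℕ.+ (b ∸ n))               ≡⟨ ≡.cong (λ j → (w * ι R (b C n)) · T^ j) exponent ⟩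
    (w * ι R (b C n)) · T^ (b ∸ r)                           ∎
    where
      open import Relation.Binary.Reasoning.Setoid 𝑃.setoid
      w : Carrier
      w = sgn R (n ∸ r) * ι R (n C r)
      r≤n : r ≤ n
      r≤n = ℕₚ.≮⇒≥ (λ n<r → ≡.subst T n<ᵇr (ℕₚ.<⇒<ᵇ n<r))
      exponent : n ∸ r ℕ.+ (b ∸ n) ≡ b ∸ r
      exponent = ≡.trans (≡.sym (ℕₚ.+-∸-comm (b ∸ n) r≤n))
                         (≡.cong (_∸ r) (≡.trans (ℕₚ.+-comm n (b ∸ n)) (ℕₚ.m∸n+n≡m n≤b)))

  kernel-base : ∀ b → b < Q → kernel b ≈ᴾ Σ (suc b) (inversionTerm b r) · T^ (b ∸ r)
  kernel-base b b<Q = 𝑃.trans (Σᴾ.Σ-cong (suc b) (λ n n<1+b → kernelTerm-base b n (ℕₚ.≤-pred n<1+b) b<Q))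
                              (Σᴾ-· (suc b) (inversionTerm b r) (T^ (b ∸ r)))

  [1+a]Q+b≡aQ+b+Q : ∀ a b → suc a ℕ.* Q ℕ.+ b ≡ a ℕ.* Q ℕ.+ b ℕ.+ Q
  [1+a]Q+b≡aQ+b+Q a b = ≡.trans (ℕₚ.+-assoc Q (a ℕ.* Q) b) (ℕₚ.+-comm Q (a ℕ.* Q ℕ.+ b))

  kernel-*Q+r : ∀ a → kernel (a ℕ.* Q ℕ.+ r) ≈ᴾ T^ (a ℕ.* P)
  kernel-*Q+r zero    = 𝑃.trans (kernel-base r r<Q)
    (λ i → trans (*-cong (Σ-inversion-diag r) (reflexive (≡.cong (λ j → (T^ j) i) (ℕₚ.n∸n≡0 r)))) (*-identityˡ _))
  kernel-*Q+r (suc a) = begin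
    kernel (suc a ℕ.* Q ℕ.+ r)          ≡⟨ ≡.cong kernel ([1+a]Q+b≡aQ+b+Q a r) ⟩
    kernel (a ℕ.* Q ℕ.+ r ℕ.+ Q)        ≈⟨ kernel-+Q (a ℕ.* Q ℕ.+ r) ⟩
    T^ P *ᴾ kernel (a ℕ.* Q ℕ.+ r)      ≈⟨ *ᴾ-cong {T^ P} 𝑃.refl (kernel-*Q+r a) ⟩
    T^ P *ᴾ T^ (a ℕ.* P)                ≈⟨ T^-*ᴾ P (a ℕ.* P) ⟩
    T^ (suc a ℕ.* P)                    ∎
    where open import Relation.Binary.Reasoning.Setoid 𝑃.setoid

  kernel-*Q+-≢r : ∀ a b → b < Q → b ≢ r → kernel (a ℕ.* Q ℕ.+ b) ≈ᴾ zeroₚ R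
  kernel-*Q+-≢r zero    b b<Q b≢r = 𝑃.trans (kernel-base b b<Q) (·-zero (T^ (b ∸ r)) (Σ-inversion-off b r b≢r))
  kernel-*Q+-≢r (suc a) b b<Q b≢r = begin
    kernel (suc a ℕ.* Q ℕ.+ b)          ≡⟨ ≡.cong kernel ([1+a]Q+b≡aQ+b+Q a b) ⟩
    kernel (a ℕ.* Q ℕ.+ b ℕ.+ Q)        ≈⟨ kernel-+Q (a ℕ.* Q ℕ.+ b) ⟩
    T^ P *ᴾ kernel (a ℕ.* Q ℕ.+ b)      ≈⟨ *ᴾ-cong {T^ P} 𝑃.refl (kernel-*Q+-≢r a b b<Q b≢r) ⟩
    T^ P *ᴾ zeroₚ R                     ≈⟨ 𝑃.zeroʳ (T^ P) ⟩
    zeroₚ R                             ∎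
    where open import Relation.Binary.Reasoning.Setoid 𝑃.setoid

  ι-PS-p≈0 : ι PS-commutativeRing p ≈ᴾ zeroₚ R
  ι-PS-p≈0 = 𝑃.trans (ι-PS p) (·-zero (oneₚ R) ι-p≈0)

  monomial-^P : ∀ a j → (a · T^ j) ^ᴾ P ≈ᴾ a · T^ (j ℕ.* P)
  monomial-^P a j = 𝑃.trans (monomial-^ᴾ a j P) (·-cong (fermat-^ a t) 𝑃.refl)

  truncate-^P : ∀ K f → truncate K f ^ᴾ P ≈ᴾ Σᴾ.Σ K (λ a → f a · T^ (a ℕ.* P))
  truncate-^P K f = 𝑃.trans frobenius (Σᴾ.Σ-cong′ K (λ a → monomial-^P (f a) a))
    where
      open Frobenius PS-commutativeRing p-prime ι-PS-p≈0 using (frobenius-Σ)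
      frobenius : truncate K f ^ᴾ P ≈ᴾ Σᴾ.Σ K (λ a → (f a · T^ a) ^ᴾ P)
      frobenius = ≡.subst (λ M → truncate K f ^ᴾ M ≈ᴾ Σᴾ.Σ K (λ a → (f a · T^ a) ^ᴾ M)) (≡.sym (q^≡p^ t))
                          (frobenius-Σ (d ℕ.* t) K (λ a → f a · T^ a))

  module _ (x : PS R) where
    y : PS R
    y = Δ R q r m x

    y^P-coef : ∀ i → _^ₚ_ R y P i ≈ Σ (suc i) (λ a → y a * (T^ (a ℕ.* P)) i)
    y^P-coef i = begin
      _^ₚ_ R y P i                                         ≈⟨ ^ₚ-agree i P (λ j j≤i → sym (truncate-coef (suc i) y j (s≤s j≤i))) i ℕₚ.≤-refl ⟩
      _^ₚ_ R (truncate (suc i) y) P i                      ≈⟨ ^ₚ≈^ᴾ (truncate (suc i) y) P i ⟩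
      (truncate (suc i) y ^ᴾ P) i                          ≈⟨ truncate-^P (suc i) y i ⟩
      Σᴾ.Σ (suc i) (λ a → y a · T^ (a ℕ.* P)) i            ≈⟨ Σᴾ-apply (suc i) (λ a → y a · T^ (a ℕ.* P)) i ⟩
      Σ (suc i) (λ a → y a * (T^ (a ℕ.* P)) i)             ∎
      where open import Relation.Binary.Reasoning.Setoid setoid

    coefD-expand : ∀ i n K → i ℕ.+ n < K → (coef n *ᴾ D R n x) i ≈ Σ K (λ k → x k * kernelTerm k n i)
    coefD-expand i n K i+n<K = begin
      (coef n *ᴾ D R n x) i
        ≈⟨ *ᴾ-agree i {coef n} (λ _ _ → refl) (D-truncate-agree i n K x i+n<K) i ℕₚ.≤-refl ⟩
      (coef n *ᴾ D R n (truncate K x)) i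
        ≈⟨ *ᴾ-cong {coef n} 𝑃.refl (D-truncate K n x) i ⟩
      (coef n *ᴾ Σᴾ.Σ K (λ k → x k · ι R (k C n) · T^ (k ∸ n))) i
        ≈⟨ Σᴾ.*-distribˡ-Σ K (coef n) _ i ⟩
      Σᴾ.Σ K (λ k → coef n *ᴾ x k · ι R (k C n) · T^ (k ∸ n)) i
        ≈⟨ Σᴾ.Σ-cong′ K (λ k → ·-*ᴾʳ (x k) (coef n) (ι R (k C n) · T^ (k ∸ n))) i ⟩
      Σᴾ.Σ K (λ k → x k · kernelTerm k n) i
        ≈⟨ Σᴾ-apply K (λ k → x k · kernelTerm k n) i ⟩
      Σ K (λ k → x k * kernelTerm k n i) ∎
      where open import Relation.Binary.Reasoning.Setoid setoid

    Σ-kernelTerm : ∀ i k N → suc i ℕ.* Q ≤ N → Σ N (λ n → kernelTerm k n i) ≈ kernel k i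
    Σ-kernelTerm i k N [1+i]Q≤N = begin
      Σ N f                  ≈⟨ Σ-extend N (suc k) f (λ n N≤n → *ᴾ-vanishesˡ (coef n) (ι R (k C n) · T^ (k ∸ n))
                                  (coef-vanishes i n (ℕₚ.≤-trans [1+i]Q≤N N≤n)) i ℕₚ.≤-refl) ⟨
      Σ (N ℕ.+ suc k) f      ≡⟨ ≡.cong (λ j → Σ j f) (ℕₚ.+-comm N (suc k)) ⟩
      Σ (suc k ℕ.+ N) f      ≈⟨ Σ-extend (suc k) N f (λ n 1+k≤n → 𝑃.trans (*ᴾ-cong {coef n} 𝑃.refl
                                  (·-zero (T^ (k ∸ n)) (reflexive (≡.cong (ι R) (k>n⇒nCk≡0 1+k≤n))))) (𝑃.zeroʳ (coef n)) i) ⟩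
      Σ (suc k) f            ≈⟨ Σᴾ-apply (suc k) (kernelTerm k) i ⟨
      kernel k i             ∎
      where
        open import Relation.Binary.Reasoning.Setoid setoid
        f : ℕ → Carrier
        f n = kernelTerm k n i

    Σ-x-kernel : ∀ i A → suc i ≤ A → Σ (A ℕ.* Q) (λ k → x k * kernel k i) ≈ Σ (suc i) (λ a → y a * (T^ (a ℕ.* P)) i)
    Σ-x-kernel i A 1+i≤A = begin
      Σ (A ℕ.* Q) (λ k → x k * kernel k i)
        ≈⟨ Σ-* A Q _ ⟩
      Σ A (λ a → Σ Q (λ b → x (a ℕ.* Q ℕ.+ b) * kernel (a ℕ.* Q ℕ.+ b) i))
        ≈⟨ Σ-cong′ A (λ a → Σ-single Q r _ r<Q (λ b b<Q b≢r → trans (*-congˡ (kernel-*Q+-≢r a b b<Q b≢r i)) (zeroʳ _))) ⟩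
      Σ A (λ a → y a * kernel (a ℕ.* Q ℕ.+ r) i)
        ≈⟨ Σ-cong′ A (λ a → *-congˡ (kernel-*Q+r a i)) ⟩
      Σ A (λ a → y a * (T^ (a ℕ.* P)) i)
        ≈⟨ Σ-extend-≤ (suc i) A _ 1+i≤A (λ a 1+i≤a → trans (*-congˡ (T^-≢ (λ i≡aP → ℕₚ.<-irrefl i≡aP
             (ℕₚ.<-≤-trans 1+i≤a (ℕₚ.m≤m*n a P))))) (zeroʳ _)) ⟩
      Σ (suc i) (λ a → y a * (T^ (a ℕ.* P)) i) ∎
      where open import Relation.Binary.Reasoning.Setoid setoid

    partialSums-stabilise : ∀ i N → suc i ℕ.* Q ≤ N →
                      sumₚ R N (λ n → coef n *ᴾ D R n x) i ≈ Σ (suc i) (λ a → y a * (T^ (a ℕ.* P)) i)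
    partialSums-stabilise i N [1+i]Q≤N = begin
      Σ N (λ n → (coef n *ᴾ D R n x) i)                   ≈⟨ Σ-cong N (λ n n<N → coefD-expand i n K (i+n<K n n<N)) ⟩
      Σ N (λ n → Σ K (λ k → x k * kernelTerm k n i))      ≈⟨ Σ-comm N K _ ⟩
      Σ K (λ k → Σ N (λ n → x k * kernelTerm k n i))      ≈⟨ Σ-cong′ K (λ k → *-distribˡ-Σ N (x k) _) ⟨
      Σ K (λ k → x k * Σ N (λ n → kernelTerm k n i))      ≈⟨ Σ-cong′ K (λ k → *-congˡ (Σ-kernelTerm i k N [1+i]Q≤N)) ⟩
      Σ K (λ k → x k * kernel k i)                        ≈⟨ Σ-x-kernel i (N ℕ.+ suc i) (ℕₚ.m≤n+m (suc i) N) ⟩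
      Σ (suc i) (λ a → y a * (T^ (a ℕ.* P)) i)            ∎
      where
        open import Relation.Binary.Reasoning.Setoid setoid
        K : ℕ
        K = (N ℕ.+ suc i) ℕ.* Q
        i+n<K : ∀ n → n < N → i ℕ.+ n < K
        i+n<K n n<N = ℕₚ.<-≤-trans (≡.subst (_< N ℕ.+ suc i) (ℕₚ.+-comm n i) (ℕₚ.+-mono-< n<N (ℕₚ.n<1+n i)))
                                    (ℕₚ.m≤m*n (N ℕ.+ suc i) Q)

    Σ-coef-D-converges : ConvergesTo R (λ n → coef n *ᴾ D R n x) (_^ₚ_ R y P)
    Σ-coef-D-converges i = suc i ℕ.* Q , λ N [1+i]Q≤N → trans (partialSums-stabilise i N [1+i]Q≤N) (sym (y^P-coef i))

open import Data.Nat using (_^_)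

mainTheorem8 : {c ℓ : Level} (R : CommutativeRing c ℓ) (q : ℕ) → IsFiniteField R q →
    (t m r : ℕ) → r < q ^ m → (x : PS R) →
    ConvergesTo R (λ n → _*ₚ_ R (Coef R q t r m n) (D R n x)) (_^ₚ_ R (Δ R q r m x) (q ^ t))
mainTheorem8 R q 𝔽 t m r r<Q x = CartierHasse.Σ-coef-D-converges R q 𝔽 t m r r<Q x
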